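{- Let $n\ge1$ and let $G$ be a graph with no loops on at most $n$ vertices. Then $$X_G^{K_n^1}=n!\cdot X_G+(n-1)!\cdot\sum_W X_{G/W},$$ where the sum is over all nonempty subsets $W\subseteq V(G)$ such that every vertex of $W$ is adjacent to at least one other vertex of $W$.
   Context: $K_n^1$ is the complete graph $K_n$ with a loop attached to one vertex (a looped vertex is adjacent to itself). A graph homomorphism $f:G\to H$ is a map $V(G)\to V(H)$ such that adjacent vertices (including a vertex with itself via a loop) map to adjacent vertices. Its type is the partition of nonzero preimage sizes. For a partition $\lambda$ with $r_i(\lambda)$ parts equal to $i$, $m_\lambda^N=\frac{N!}{\binom{N}{r_1(\lambda),r_2(\lambda),\dots,N-\ell(\lambda)}}m_\lambda$ with $m_\lambda$ the monomial symmetric function; $X_G^H=\sum_\lambda d_\lambda m_\lambda^{|V(H)|}$ with $d_\lambda$ the number of homomorphisms $G\to H$ of type $\lambda$. For a vertex-weighted loopless graph $G$ with weights $w:V(G)\to\{1,2,\dots\}$, the chromatic symmetric function is $X_G=\sum_\kappa\prod_{v\in V(G)}x_{\kappa(v)}^{w(v)}$, summed over proper colorings $\kappa:V(G)\to\{1,2,\dots\}$ (adjacent vertices get distinct colors); for an unweighted graph all weights are $1$ (the usual chromatic symmetric function). For $W\subseteq V(G)$, $G/W$ is the weighted graph obtained by contracting all vertices of $W$ into a single vertex of weight equal to the sum of their weights (here $|W|$), adjacent to exactly those vertices outside $W$ having at least one neighbor in $W$; all other vertices keep weight $1$ and their adjacencies. -}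

module Defs where

open import Data.Bool using (Bool; true; false; not; _∧_; _∨_; if_then_else_)
open import Data.Nat using (ℕ; zero; suc; _+_; _*_; _∸_; _≤ᵇ_; _≡ᵇ_; _!)
open import Data.Fin using (Fin; zero; suc; toℕ)
open import Data.List using (List; []; _∷_; map; concatMap; length; filterᵇ; tabulate; lookup; foldr)
open import Data.Nat.ListAction using (sum; product)
open import Data.Bool.ListAction using (and)
open import Relation.Binary.PropositionalEquality using (_≡_)

allFuns : {A : Set} → (k : ℕ) → List A → List (Fin k → A)
allFuns zero    xs = (λ ()) ∷ []
allFuns (suc k) xs =
  concatMap (λ c → map (λ f → λ { zero → c ; (suc i) → f i }) (allFuns k xs)) xs

allFin : (k : ℕ) → List (Fin k)
allFin k = tabulate (λ i → i)

_==_ : {k : ℕ} → Fin k → Fin k → Bool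
i == j = toℕ i ≡ᵇ toℕ j

sumFin : (k : ℕ) → (Fin k → ℕ) → ℕ
sumFin k f = sum (tabulate f)

countFin : (k : ℕ) → (Fin k → Bool) → ℕ
countFin k p = length (filterᵇ p (allFin k))

allFinᵇ : (k : ℕ) → (Fin k → Bool) → Bool
allFinᵇ k p = and (map p (allFin k))

-- Partitions, represented as weakly decreasing lists of positive naturals

insertDesc : ℕ → List ℕ → List ℕ
insertDesc x [] = x ∷ []
insertDesc x (y ∷ ys) = if y ≤ᵇ x then x ∷ y ∷ ys else y ∷ insertDesc x ys

sortDesc : List ℕ → List ℕ
sortDesc = foldr insertDesc []

partitionOf : List ℕ → List ℕ
partitionOf xs = sortDesc (filterᵇ (λ x → not (x ≡ᵇ 0)) xs)

_==ℓ_ : List ℕ → List ℕ → Bool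
[]       ==ℓ []       = true
(x ∷ xs) ==ℓ (y ∷ ys) = (x ≡ᵇ y) ∧ (xs ==ℓ ys)
_        ==ℓ _        = false

mult : ℕ → List ℕ → ℕ
mult i λ' = length (filterᵇ (λ x → x ≡ᵇ i) λ')

-- The scalar N! / binom(N; r_1(λ), r_2(λ), ..., N - ℓ(λ)), which equals
-- r_1(λ)! r_2(λ)! ⋯ (N - ℓ(λ))!  (parts of λ are ≤ |λ| = sum λ).
scaleFactor : ℕ → List ℕ → ℕ
scaleFactor N λ' = product (tabulate {n = sum λ'} (λ i → (mult (suc (toℕ i)) λ') !)) * (N ∸ length λ') !

record Graph (k : ℕ) : Set where
  field
    adj      : Fin k → Fin k → Bool
    sym      : ∀ u v → adj u v ≡ adj v u
    loopless : ∀ v → adj v v ≡ false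

-- adjacency of K_n^1: complete graph on Fin n with a loop at vertex 0
adjKLoop : (n : ℕ) → Fin n → Fin n → Bool
adjKLoop n i j = ((toℕ i ≡ᵇ 0) ∧ (toℕ j ≡ᵇ 0)) ∨ not (i == j)

isHomᵇ : {k : ℕ} (n : ℕ) → Graph k → (Fin k → Fin n) → Bool
isHomᵇ {k} n G f =
  allFinᵇ k (λ u → allFinᵇ k (λ v → not (Graph.adj G u v) ∨ adjKLoop n (f u) (f v)))

typeOf : {k n : ℕ} → (Fin k → Fin n) → List ℕ
typeOf {k} {n} f = partitionOf (tabulate {n = n} (λ c → countFin k (λ v → f v == c)))

-- Polynomials/symmetric functions are compared coefficientwise in finitely
-- many variables x_1 … x_m (all further variables set to 0): a monomial
-- x_1^{α 0} ⋯ x_m^{α (m-1)} is given by α : Fin m → ℕ.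

coeffMono : (m : ℕ) → (Fin m → ℕ) → List ℕ → ℕ
coeffMono m α λ' = if partitionOf (tabulate α) ==ℓ λ' then 1 else 0

-- coefficient of x^α in X_G^{K_n^1} = Σ_λ d_λ m_λ^n
--   = Σ_{f : G → K_n^1 homomorphism} m^n_{type f}
coeffXHom : {k : ℕ} (n : ℕ) → Graph k → (m : ℕ) → (Fin m → ℕ) → ℕ
coeffXHom {k} n G m α =
  sum (map (λ f → scaleFactor n (typeOf f) * coeffMono m α (typeOf f))
           (filterᵇ (isHomᵇ n G) (allFuns k (allFin n))))

record WGraph : Set where
  field
    size : ℕ
    adj  : Fin size → Fin size → Bool
    wt   : Fin size → ℕ

unweighted : {k : ℕ} → Graph k → WGraph
unweighted {k} G = record { size = k ; adj = Graph.adj G ; wt = λ _ → 1 }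

coeffX : WGraph → (m : ℕ) → (Fin m → ℕ) → ℕ
coeffX H m α = length (filterᵇ ok (allFuns j (allFin m)))
  where
  j = WGraph.size H
  proper : (Fin j → Fin m) → Bool
  proper κ = allFinᵇ j (λ u → allFinᵇ j (λ v → not (WGraph.adj H u v ∧ (κ u == κ v))))
  weights : (Fin j → Fin m) → Bool
  weights κ = allFinᵇ m (λ c → sumFin j (λ v → if κ v == c then WGraph.wt H v else 0) ≡ᵇ α c)
  ok : (Fin j → Fin m) → Bool
  ok κ = proper κ ∧ weights κ

allSubsets : (k : ℕ) → List (Fin k → Bool)
allSubsets k = allFuns k (true ∷ false ∷ [])

admissibleᵇ : {k : ℕ} → Graph k → (Fin k → Bool) → Bool
admissibleᵇ {k} G W =
  not (countFin k W ≡ᵇ 0) ∧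
  allFinᵇ k (λ v → not (W v) ∨
    not (countFin k (λ u → W u ∧ not (u == v) ∧ Graph.adj G v u) ≡ᵇ 0))

admissibleSubsets : {k : ℕ} → Graph k → List (Fin k → Bool)
admissibleSubsets {k} G = filterᵇ (admissibleᵇ G) (allSubsets k)

-- contraction G/W: vertex 0 is the contracted vertex (weight |W|),
-- vertex (suc i) is the i-th vertex outside W (weight 1)
contract : {k : ℕ} → Graph k → (Fin k → Bool) → WGraph
contract {k} G W = record { size = suc r ; adj = a ; wt = w }
  where
  outs : List (Fin k)
  outs = filterᵇ (λ v → not (W v)) (allFin k)
  r = length outs
  out : Fin r → Fin k
  out = lookup outs
  touchesW : Fin k → Bool
  touchesW v = not (countFin k (λ u → W u ∧ Graph.adj G u v) ≡ᵇ 0)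
  a : Fin (suc r) → Fin (suc r) → Bool
  a zero    zero    = false
  a zero    (suc j) = touchesW (out j)
  a (suc i) zero    = touchesW (out i)
  a (suc i) (suc j) = Graph.adj G (out i) (out j)
  w : Fin (suc r) → ℕ
  w zero    = countFin k W
  w (suc i) = 1

{-# OPTIONS --safe #-}
module Submission where

-- A homomorphism f : G → K_n^1 of type λ contributes r₁(λ)! r₂(λ)! ⋯ (n − ℓ)! m_λ, and
-- r₁(λ)! r₂(λ)! ⋯ times the coefficient of x^α in m_λ counts the colorings κ whose color
-- classes have sizes α and which have the same kernel as f: such a κ assigns the fibers
-- of f injectively to colors, and fibers of equal size can be permuted. Exchanging the
-- two sums, for a fixed κ with ℓ classes one counts the homomorphisms with kernel ker κ.
-- Such an f is injective on the classes of κ, and it is a homomorphism exactly when it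
-- sends every vertex on a κ-monochromatic edge to the looped vertex. So there are
-- n!/(n − ℓ)! of them if κ is proper, (n − 1)!/(n − ℓ)! if those vertices form a
-- nonempty set W inside one color class, and none otherwise. In the middle case W is
-- admissible, κ is the lift of a proper coloring of G/W with the same color sizes, and
-- W is determined by κ.

open import Defs

open import Data.Bool using (Bool; true; false; T; not; _∧_; _∨_; if_then_else_)
open import Data.Bool.ListAction using (and)
open import Data.Bool.Properties using (T-∧; T-∨) renaming (_≟_ to _≟ᵇ_)
open import Data.Empty using (⊥-elim)
open import Data.Fin using (Fin; zero; suc; toℕ)
open import Data.Fin.Properties using (_≟_; toℕ-injective; suc-injective; all?; any?)
open import Data.List using (List; []; _∷_; _++_; map; concatMap; length; filterᵇ; tabulate; lookup)
open import Data.List.Properties using (map-id; ≡-dec; tabulate-cong)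
open import Data.List.Membership.Propositional using (_∈_)
open import Data.List.Membership.Propositional.Properties using (∈-lookup; ∈-filter⁺; ∈-allFin)
open import Data.List.Relation.Binary.Permutation.Propositional using (_↭_; prep; swap; ↭-refl; ↭-sym; ↭-trans)
open import Data.List.Relation.Binary.Permutation.Propositional.Properties using (↭-length; filter-↭; All-resp-↭)
open import Data.List.Relation.Unary.All as All using (All; []; _∷_)
open import Data.List.Relation.Unary.All.Properties using (all-filter)
open import Data.List.Relation.Unary.AllPairs using (AllPairs; []; _∷_)
import Data.List.Relation.Unary.Any as Any
open import Data.List.Relation.Unary.Any.Properties using (lookup-index)
open import Data.List.Relation.Unary.Unique.Propositional using (Unique)
import Data.List.Relation.Unary.Unique.Propositional.Properties as Unique
open import Data.Nat using (ℕ; zero; suc; _+_; _*_; _∸_; _≤_; _<_; _≥_; _≡ᵇ_; _≤ᵇ_; _!; z≤n; s≤s)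
  renaming (_≟_ to _≟ℕ_)
open import Data.Nat.Combinatorics.Base using (_P′_)
open import Data.Nat.ListAction using (sum; product)
open import Data.Nat.ListAction.Properties using (sum-↭)
open import Data.Nat.Properties
  using ( +-assoc; +-comm; +-identityʳ; +-cancelˡ-≡; +-mono-≤; +-∸-assoc; ∸-+-assoc; m+n∸n≡m
        ; *-assoc; *-comm; *-identityˡ; *-identityʳ; *-zeroʳ; *-distribˡ-+; *-distribʳ-+
        ; ≤-trans; ≤-<-trans; <⇒≤; <⇒≢; ≰⇒>; ≮⇒≥; <-cmp; m≤m+n; m≤n+m; n≤0⇒n≡0; 1+n≢0
        ; ≡ᵇ⇒≡; ≡⇒≡ᵇ; ≤ᵇ⇒≤; ≤⇒≤ᵇ
        ; +-commutativeSemigroup; *-commutativeSemigroup; +-*-semiring )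
open import Algebra.Properties.CommutativeSemigroup +-commutativeSemigroup
  using () renaming (interchange to +-interchange; x∙yz≈y∙xz to +-left-comm)
open import Algebra.Properties.CommutativeSemigroup *-commutativeSemigroup
  using () renaming (x∙yz≈y∙xz to *-left-comm)
open import Algebra.Properties.Semiring.Sum +-*-semiring
  using (sum-syntax; ∑-distrib-+; ∑-comm; *-distribˡ-sum; *-distribʳ-sum; sum-cong-≗; sum-replicate-zero)
open import Data.Product using (∃; _×_; _,_; proj₁; proj₂)
open import Data.Product.Function.NonDependent.Propositional using (_×-⇔_)
open import Data.Sum using (_⊎_; inj₁; inj₂; map₂)
open import Data.Sum.Function.Propositional using (_⊎-⇔_)
open import Data.Unit using (tt)
open import Data.Vec.Functional using (tail; updateAt) renaming (_∷_ to _∷ᶠ_)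
open import Data.Vec.Functional.Properties using (updateAt-updates; updateAt-minimal)
open import Function using (_∘_; case_of_)
open import Function.Bundles using (_⇔_; mk⇔; Equivalence)
open import Function.Construct.Composition using (_⇔-∘_)
open import Function.Construct.Symmetry using (⇔-sym)
open import Function.Related.TypeIsomorphisms using (¬-cong-⇔)
open import Relation.Binary.Definitions using (tri<; tri≈; tri>)
open import Relation.Binary.PropositionalEquality
open import Relation.Nullary
  using (Dec; yes; no; _because_; ¬_; ¬?; contradiction; _×-dec_; _⊎-dec_; _→-dec_; T?; map′; isYes; toWitness; fromWitness)

open Equivalence using (to; from)

private variable
  a b k m n : ℕ
  A B : Set
  P Q R S : Set

-- Iverson brackets and Booleans

-- Matching on the record, rather than computing from `does`, keeps P? inferable from
-- ⟦ P? ⟧; in exchange ⟦ map′ f g P? ⟧ and ⟦ P? ⟧ are only propositionally equal.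
⟦_⟧ : Dec P → ℕ
⟦ true  because _ ⟧ = 1
⟦ false because _ ⟧ = 0

⟦⟧-yes : (P? : Dec P) → P → ⟦ P? ⟧ ≡ 1
⟦⟧-yes (yes _) _ = refl
⟦⟧-yes (no ¬p) p = contradiction p ¬p

⟦⟧-no : (P? : Dec P) → ¬ P → ⟦ P? ⟧ ≡ 0
⟦⟧-no (yes p) ¬p = contradiction p ¬p
⟦⟧-no (no _)  _  = refl

⟦⟧≤1 : (P? : Dec P) → ⟦ P? ⟧ ≤ 1
⟦⟧≤1 (yes _) = s≤s z≤n
⟦⟧≤1 (no _)  = z≤n

⟦⟧-cong : {P? : Dec P} {Q? : Dec Q} → P ⇔ Q → ⟦ P? ⟧ ≡ ⟦ Q? ⟧
⟦⟧-cong {P? = yes p} {yes q}  _   = refl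
⟦⟧-cong {P? = yes p} {no ¬q}  P⇔Q = contradiction (to P⇔Q p) ¬q
⟦⟧-cong {P? = no ¬p} {yes q}  P⇔Q = contradiction (from P⇔Q q) ¬p
⟦⟧-cong {P? = no ¬p} {no ¬q}  _   = refl

⟦⟧-× : (P? : Dec P) (Q? : Dec Q) → ⟦ P? ×-dec Q? ⟧ ≡ ⟦ P? ⟧ * ⟦ Q? ⟧
⟦⟧-× (yes _) (yes _) = refl
⟦⟧-× (yes _) (no _)  = refl
⟦⟧-× (no _)  _       = refl

⟦⟧-⊎ : (P? : Dec P) (Q? : Dec Q) → ⟦ P? ⊎-dec Q? ⟧ ≡ ⟦ Q? ⟧ + ⟦ P? ⟧ * ⟦ ¬? Q? ⟧
⟦⟧-⊎ (yes _) (yes _) = refl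
⟦⟧-⊎ (yes _) (no _)  = refl
⟦⟧-⊎ (no _)  (yes _) = refl
⟦⟧-⊎ (no _)  (no _)  = refl

⟦⟧-split : (P? : Dec P) (Q? : Dec Q) → ⟦ P? ⟧ ≡ ⟦ P? ×-dec ¬? Q? ⟧ + ⟦ P? ×-dec Q? ⟧
⟦⟧-split (yes _) (yes _) = refl
⟦⟧-split (yes _) (no _)  = refl
⟦⟧-split (no _)  _       = refl

⟦⟧*⟦⟧-cong : {P? : Dec P} {Q? : Dec Q} {R? : Dec R} {S? : Dec S} →
             (P × Q) ⇔ (R × S) → ⟦ P? ⟧ * ⟦ Q? ⟧ ≡ ⟦ R? ⟧ * ⟦ S? ⟧
⟦⟧*⟦⟧-cong {P? = P?} {Q?} {R?} {S?} e =
  trans (sym (⟦⟧-× P? Q?)) (trans (⟦⟧-cong {P? = P? ×-dec Q?} {Q? = R? ×-dec S?} e) (⟦⟧-× R? S?))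

⟦⟧-×-cong : {P? : Dec P} {Q? : Dec Q} {R? : Dec R} {S? : Dec S} →
            (P × Q) ⇔ (R × S) → ⟦ P? ×-dec Q? ⟧ ≡ ⟦ R? ⟧ * ⟦ S? ⟧
⟦⟧-×-cong {P? = P?} {Q?} {R?} {S?} e = trans (⟦⟧-cong {P? = P? ×-dec Q?} {Q? = R? ×-dec S?} e) (⟦⟧-× R? S?)

⟦⟧*-cong : (P? : Dec P) {x y : ℕ} → (P → x ≡ y) → ⟦ P? ⟧ * x ≡ ⟦ P? ⟧ * y
⟦⟧*-cong (yes p) x≡y = cong (_+ 0) (x≡y p)
⟦⟧*-cong (no _)  _   = refl

*⟦⟧-cong : (P? : Dec P) {x y : ℕ} → (P → x ≡ y) → x * ⟦ P? ⟧ ≡ y * ⟦ P? ⟧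
*⟦⟧-cong P? {x} {y} x≡y = trans (*-comm x ⟦ P? ⟧) (trans (⟦⟧*-cong P? x≡y) (*-comm ⟦ P? ⟧ y))

⟦suc≟suc⟧ : (i j : Fin n) → ⟦ suc i ≟ suc j ⟧ ≡ ⟦ i ≟ j ⟧
⟦suc≟suc⟧ i j = ⟦⟧-cong (mk⇔ suc-injective (cong suc))

_⇔-dec_ : Dec P → Dec Q → Dec (P ⇔ Q)
P? ⇔-dec Q? = map′ (λ (f , g) → mk⇔ f g) (λ e → to e , from e) ((P? →-dec Q?) ×-dec (Q? →-dec P?))

≡-sym-⇔ : {A : Set} {x y : A} → (x ≡ y) ⇔ (y ≡ x)
≡-sym-⇔ = mk⇔ sym sym

T-not : (b : Bool) → T (not b) ⇔ (¬ T b)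
T-not true  = mk⇔ (λ ()) (λ ¬t → ¬t tt)
T-not false = mk⇔ (λ _ ()) (λ _ → tt)

T-≡ᵇ : (x y : ℕ) → T (x ≡ᵇ y) ⇔ (x ≡ y)
T-≡ᵇ x y = mk⇔ (≡ᵇ⇒≡ x y) (≡⇒≡ᵇ x y)

T-implies : (a b : Bool) → T (not a ∨ b) ⇔ (T a → T b)
T-implies true  b = mk⇔ (λ t _ → t) (λ h → h tt)
T-implies false b = mk⇔ (λ _ ()) (λ _ → tt)

T-⇔→≡ : {a b : Bool} → T a ⇔ T b → a ≡ b
T-⇔→≡ {true}  {true}  _   = refl
T-⇔→≡ {true}  {false} a⇔b = contradiction (to a⇔b tt) λ ()
T-⇔→≡ {false} {true}  a⇔b = contradiction (from a⇔b tt) λ ()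
T-⇔→≡ {false} {false} _   = refl

T-not-≡ᵇ0 : (x : ℕ) → T (not (x ≡ᵇ 0)) ⇔ 0 < x
T-not-≡ᵇ0 zero    = mk⇔ (λ ()) (λ ())
T-not-≡ᵇ0 (suc x) = mk⇔ (λ _ → s≤s z≤n) (λ _ → tt)

sumMap : List A → (A → ℕ) → ℕ
sumMap L F = sum (map F L)

syntax sumMap L (λ x → F) = ∑[ x ← L ] F

∑←-cong : (L : List A) {F G : A → ℕ} → (∀ x → F x ≡ G x) → ∑[ x ← L ] F x ≡ ∑[ x ← L ] G x
∑←-cong []      F≗G = refl
∑←-cong (x ∷ L) F≗G = cong₂ _+_ (F≗G x) (∑←-cong L F≗G)

∑←-++ : (L M : List A) (F : A → ℕ) → ∑[ x ← L ++ M ] F x ≡ ∑[ x ← L ] F x + ∑[ x ← M ] F x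
∑←-++ []      M F = refl
∑←-++ (x ∷ L) M F = trans (cong (F x +_) (∑←-++ L M F)) (sym (+-assoc (F x) _ _))

∑←-map : (g : A → B) (L : List A) (F : B → ℕ) → ∑[ y ← map g L ] F y ≡ ∑[ x ← L ] F (g x)
∑←-map g []      F = refl
∑←-map g (x ∷ L) F = cong (F (g x) +_) (∑←-map g L F)

∑←-concatMap : (g : A → List B) (L : List A) (F : B → ℕ) →
               ∑[ y ← concatMap g L ] F y ≡ ∑[ x ← L ] ∑[ y ← g x ] F y
∑←-concatMap g []      F = refl
∑←-concatMap g (x ∷ L) F =
  trans (∑←-++ (g x) (concatMap g L) F) (cong (∑[ y ← g x ] F y +_) (∑←-concatMap g L F))

∑←-zero : (L : List A) → ∑[ x ← L ] 0 ≡ 0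
∑←-zero []      = refl
∑←-zero (x ∷ L) = ∑←-zero L

∑←-distrib-+ : (L : List A) (F G : A → ℕ) →
               ∑[ x ← L ] (F x + G x) ≡ ∑[ x ← L ] F x + ∑[ x ← L ] G x
∑←-distrib-+ []      F G = refl
∑←-distrib-+ (x ∷ L) F G =
  trans (cong (F x + G x +_) (∑←-distrib-+ L F G)) (+-interchange (F x) (G x) _ _)

*-distribˡ-∑← : (c : ℕ) (L : List A) (F : A → ℕ) → c * ∑[ x ← L ] F x ≡ ∑[ x ← L ] (c * F x)
*-distribˡ-∑← c []      F = *-zeroʳ c
*-distribˡ-∑← c (x ∷ L) F = trans (*-distribˡ-+ c (F x) _) (cong (c * F x +_) (*-distribˡ-∑← c L F))

*-distribʳ-∑← : (c : ℕ) (L : List A) (F : A → ℕ) → ∑[ x ← L ] F x * c ≡ ∑[ x ← L ] (F x * c)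
*-distribʳ-∑← c []      F = refl
*-distribʳ-∑← c (x ∷ L) F = trans (*-distribʳ-+ c (F x) _) (cong (F x * c +_) (*-distribʳ-∑← c L F))

∑←-comm : (L : List A) (M : List B) (F : A → B → ℕ) →
          ∑[ x ← L ] ∑[ y ← M ] F x y ≡ ∑[ y ← M ] ∑[ x ← L ] F x y
∑←-comm []      M F = sym (∑←-zero M)
∑←-comm (x ∷ L) M F =
  trans (cong (∑[ y ← M ] F x y +_) (∑←-comm L M F)) (sym (∑←-distrib-+ M (F x) _))

∑←-split : (L : List A) (h p q : A → ℕ) (a b : ℕ) →
           ∑[ x ← L ] (h x * (a * p x + b * q x)) ≡ a * ∑[ x ← L ] (h x * p x) + b * ∑[ x ← L ] (h x * q x)
∑←-split L h p q a b = begin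
  ∑[ x ← L ] (h x * (a * p x + b * q x))
    ≡⟨ ∑←-cong L (λ x → trans (*-distribˡ-+ (h x) (a * p x) (b * q x))
                              (cong₂ _+_ (*-left-comm (h x) a (p x)) (*-left-comm (h x) b (q x)))) ⟩
  ∑[ x ← L ] (a * (h x * p x) + b * (h x * q x))
    ≡⟨ ∑←-distrib-+ L (λ x → a * (h x * p x)) (λ x → b * (h x * q x)) ⟩
  ∑[ x ← L ] (a * (h x * p x)) + ∑[ x ← L ] (b * (h x * q x))
    ≡⟨ cong₂ _+_ (*-distribˡ-∑← a L λ x → h x * p x) (*-distribˡ-∑← b L λ x → h x * q x) ⟨
  a * ∑[ x ← L ] (h x * p x) + b * ∑[ x ← L ] (h x * q x) ∎
  where open ≡-Reasoning

∑←-filterᵇ : (p : A → Bool) (L : List A) (F : A → ℕ) →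
             ∑[ x ← filterᵇ p L ] F x ≡ ∑[ x ← L ] (⟦ T? (p x) ⟧ * F x)
∑←-filterᵇ p []      F = refl
∑←-filterᵇ p (x ∷ L) F with p x
... | true  = cong₂ _+_ (sym (+-identityʳ (F x))) (∑←-filterᵇ p L F)
... | false = ∑←-filterᵇ p L F

length-filterᵇ : (p : A → Bool) (L : List A) → length (filterᵇ p L) ≡ ∑[ x ← L ] ⟦ T? (p x) ⟧
length-filterᵇ p []      = refl
length-filterᵇ p (x ∷ L) with p x
... | true  = cong suc (length-filterᵇ p L)
... | false = length-filterᵇ p L

∑←-tabulate : (g : Fin n → A) (F : A → ℕ) → ∑[ x ← tabulate g ] F x ≡ ∑[ i < n ] F (g i)
∑←-tabulate {zero}  g F = refl
∑←-tabulate {suc n} g F = cong (F (g zero) +_) (∑←-tabulate (g ∘ suc) F)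

∑←-lookup : (xs : List A) (F : A → ℕ) → ∑[ x ← xs ] F x ≡ ∑[ i < length xs ] F (lookup xs i)
∑←-lookup []       F = refl
∑←-lookup (x ∷ xs) F = cong (F x +_) (∑←-lookup xs F)

lookup-injective : {xs : List A} → Unique xs → ∀ i j → lookup xs i ≡ lookup xs j → i ≡ j
lookup-injective (_   ∷ _)  zero    zero    _ = refl
lookup-injective (x∉ ∷ _)  zero    (suc j) e = contradiction e (All.lookup x∉ (∈-lookup j))
lookup-injective (x∉ ∷ _)  (suc i) zero    e = contradiction (sym e) (All.lookup x∉ (∈-lookup i))
lookup-injective (_   ∷ u)  (suc i) (suc j) e = cong suc (lookup-injective u i j e)

∑-δ : (j : Fin n) (h : Fin n → ℕ) → ∑[ i < n ] (⟦ i ≟ j ⟧ * h i) ≡ h j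
∑-δ {suc n} zero    h = trans (cong₂ _+_ (+-identityʳ (h zero)) (sum-replicate-zero n)) (+-identityʳ (h zero))
∑-δ {suc n} (suc j) h =
  trans (sum-cong-≗ λ i → cong (_* h (suc i)) (⟦suc≟suc⟧ i j)) (∑-δ j (h ∘ suc))

∑-δ′ : (j : Fin n) (h : Fin n → ℕ) → ∑[ i < n ] (⟦ j ≟ i ⟧ * h i) ≡ h j
∑-δ′ j h = trans (sum-cong-≗ λ i → cong (_* h i) (⟦⟧-cong {P? = j ≟ i} {Q? = i ≟ j} (mk⇔ sym sym))) (∑-δ j h)

∑-term≤ : (h : Fin n → ℕ) (j : Fin n) → h j ≤ ∑[ i < n ] h i
∑-term≤ h zero    = m≤m+n (h zero) _
∑-term≤ h (suc j) = ≤-trans (∑-term≤ (h ∘ suc) j) (m≤n+m _ (h zero))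

-- Sums over all functions between finite sets

funs : (k : ℕ) → List A → List (Fin k → A)
funs zero    L = (λ ()) ∷ []
funs (suc k) L = concatMap (λ c → map (c ∷ᶠ_) (funs k L)) L

∑-funs-suc : (L : List A) (F : (Fin (suc k) → A) → ℕ) →
             ∑[ f ← funs (suc k) L ] F f ≡ ∑[ c ← L ] ∑[ f ← funs k L ] F (c ∷ᶠ f)
∑-funs-suc {k = k} L F = trans (∑←-concatMap _ L F) (∑←-cong L λ c → ∑←-map (c ∷ᶠ_) (funs k L) F)

Respects≗ : ((Fin k → A) → ℕ) → Set
Respects≗ F = ∀ {f g} → (∀ i → f i ≡ g i) → F f ≡ F g

-- `allFuns` extends functions by pattern lambdas, which are not definitionally `c ∷ᶠ f`.
∑-allFuns : (L : List A) (F : (Fin k → A) → ℕ) → Respects≗ F →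
            ∑[ f ← allFuns k L ] F f ≡ ∑[ f ← funs k L ] F f
∑-allFuns {k = zero}  L F resp = refl
∑-allFuns {k = suc k} L F resp = begin
  ∑[ f ← allFuns (suc k) L ] F f
    ≡⟨ ∑←-concatMap _ L F ⟩
  ∑[ c ← L ] ∑[ f ← map _ (allFuns k L) ] F f
    ≡⟨ ∑←-cong L (λ c → ∑←-map _ (allFuns k L) F) ⟩
  ∑[ c ← L ] ∑[ f ← allFuns k L ] F _
    ≡⟨ ∑←-cong L (λ c → ∑-allFuns L _ λ f≗g → resp λ { zero → refl ; (suc i) → f≗g i }) ⟩
  ∑[ c ← L ] ∑[ f ← funs k L ] F _
    ≡⟨ ∑←-cong L (λ c → ∑←-cong (funs k L) λ f → resp λ { zero → refl ; (suc i) → refl }) ⟩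
  ∑[ c ← L ] ∑[ f ← funs k L ] F (c ∷ᶠ f)
    ≡⟨ ∑-funs-suc L F ⟨
  ∑[ f ← funs (suc k) L ] F f ∎
  where open ≡-Reasoning

∑-funs-unique : {R : Fin k → A → Set} (L : List A) (R? : ∀ i c → Dec (R i c)) →
                (∀ i → ∑[ c ← L ] ⟦ R? i c ⟧ ≡ 1) →
                ∑[ f ← funs k L ] ⟦ all? (λ i → R? i (f i)) ⟧ ≡ 1
∑-funs-unique {k = zero}  L R? unique = refl
∑-funs-unique {k = suc k} {R = R} L R? unique = begin
  ∑[ f ← funs (suc k) L ] ⟦ all? (λ i → R? i (f i)) ⟧
    ≡⟨ ∑-funs-suc L _ ⟩
  ∑[ c ← L ] ∑[ f ← funs k L ] ⟦ all? (λ i → R? i ((c ∷ᶠ f) i)) ⟧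
    ≡⟨ ∑←-cong L (λ c → ∑←-cong (funs k L) λ f → trans (⟦⟧-cong ∀-cons-⇔) (⟦⟧-× (R? zero c) _)) ⟩
  ∑[ c ← L ] ∑[ f ← funs k L ] (⟦ R? zero c ⟧ * ⟦ all? (λ i → R? (suc i) (f i)) ⟧)
    ≡⟨ ∑←-cong L (λ c → sym (*-distribˡ-∑← ⟦ R? zero c ⟧ (funs k L) _)) ⟩
  ∑[ c ← L ] (⟦ R? zero c ⟧ * ∑[ f ← funs k L ] ⟦ all? (λ i → R? (suc i) (f i)) ⟧)
    ≡⟨ ∑←-cong L (λ c → cong (⟦ R? zero c ⟧ *_) (∑-funs-unique L (R? ∘ suc) (unique ∘ suc))) ⟩
  ∑[ c ← L ] (⟦ R? zero c ⟧ * 1)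
    ≡⟨ ∑←-cong L (λ c → *-identityʳ ⟦ R? zero c ⟧) ⟩
  ∑[ c ← L ] ⟦ R? zero c ⟧
    ≡⟨ unique zero ⟩
  1 ∎
  where
  open ≡-Reasoning
  ∀-cons-⇔ : ∀ {c f} → (∀ i → R i ((c ∷ᶠ f) i)) ⇔ (R zero c × ∀ i → R (suc i) (f i))
  ∀-cons-⇔ = mk⇔ (λ h → h zero , h ∘ suc) (λ { (r₀ , r₊) zero → r₀ ; (r₀ , r₊) (suc i) → r₊ i })

∑-funs-≗ : (g : Fin k → Fin m) → ∑[ f ← funs k (allFin m) ] ⟦ all? (λ i → g i ≟ f i) ⟧ ≡ 1
∑-funs-≗ {m = m} g = ∑-funs-unique (allFin m) (λ i c → g i ≟ c) λ i →
  trans (∑←-tabulate (λ c → c) λ c → ⟦ g i ≟ c ⟧)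
        (trans (sum-cong-≗ λ c → sym (*-identityʳ ⟦ g i ≟ c ⟧)) (∑-δ′ (g i) λ _ → 1))

-- Both sides count the pairs (κ , κ′) with κ ∘ s = κ′, equivalently with κ′ ∘ e = κ.
module _ {j : ℕ} {X : (Fin k → Fin m) → Set} {Y : (Fin j → Fin m) → Set}
         (X? : ∀ κ → Dec (X κ)) (Y? : ∀ κ → Dec (Y κ))
         (s : Fin j → Fin k) (e : Fin k → Fin j) (e∘s : ∀ i → e (s i) ≡ i)
         (Y-resp : ∀ {κ κ′} → (∀ i → κ i ≡ κ′ i) → Y κ → Y κ′)
         (X⇔ : ∀ κ → X κ ⇔ (Y (κ ∘ s) × ∀ v → κ (s (e v)) ≡ κ v)) where

  ∑-funs-reindex : ∑[ κ ← funs k (allFin m) ] ⟦ X? κ ⟧ ≡ ∑[ κ′ ← funs j (allFin m) ] ⟦ Y? κ′ ⟧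
  ∑-funs-reindex = begin
    ∑[ κ ← Ks ] ⟦ X? κ ⟧
      ≡⟨ ∑←-cong Ks (λ κ → trans (sym (*-identityʳ ⟦ X? κ ⟧)) (cong (⟦ X? κ ⟧ *_) (sym (∑-funs-≗ (κ ∘ s))))) ⟩
    ∑[ κ ← Ks ] (⟦ X? κ ⟧ * ∑[ κ′ ← Ks′ ] ⟦ restricts? κ κ′ ⟧)
      ≡⟨ ∑←-cong Ks (λ κ → *-distribˡ-∑← ⟦ X? κ ⟧ Ks′ λ κ′ → ⟦ restricts? κ κ′ ⟧) ⟩
    ∑[ κ ← Ks ] ∑[ κ′ ← Ks′ ] (⟦ X? κ ⟧ * ⟦ restricts? κ κ′ ⟧)
      ≡⟨ ∑←-comm Ks Ks′ (λ κ κ′ → ⟦ X? κ ⟧ * ⟦ restricts? κ κ′ ⟧) ⟩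
    ∑[ κ′ ← Ks′ ] ∑[ κ ← Ks ] (⟦ X? κ ⟧ * ⟦ restricts? κ κ′ ⟧)
      ≡⟨ ∑←-cong Ks′ (λ κ′ → ∑←-cong Ks λ κ → ⟦⟧*⟦⟧-cong {P? = X? κ} {Q? = restricts? κ κ′}
                                                         {R? = Y? κ′} {S? = extends? κ′ κ} swap-roles) ⟩
    ∑[ κ′ ← Ks′ ] ∑[ κ ← Ks ] (⟦ Y? κ′ ⟧ * ⟦ extends? κ′ κ ⟧)
      ≡⟨ ∑←-cong Ks′ (λ κ′ → sym (*-distribˡ-∑← ⟦ Y? κ′ ⟧ Ks λ κ → ⟦ extends? κ′ κ ⟧)) ⟩
    ∑[ κ′ ← Ks′ ] (⟦ Y? κ′ ⟧ * ∑[ κ ← Ks ] ⟦ extends? κ′ κ ⟧)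
      ≡⟨ ∑←-cong Ks′ (λ κ′ → trans (cong (⟦ Y? κ′ ⟧ *_) (∑-funs-≗ (κ′ ∘ e))) (*-identityʳ ⟦ Y? κ′ ⟧)) ⟩
    ∑[ κ′ ← Ks′ ] ⟦ Y? κ′ ⟧ ∎
    where
    open ≡-Reasoning
    Ks = funs k (allFin m)
    Ks′ = funs j (allFin m)
    restricts? : (κ : Fin k → Fin m) (κ′ : Fin j → Fin m) → Dec (∀ i → κ (s i) ≡ κ′ i)
    restricts? κ κ′ = all? λ i → κ (s i) ≟ κ′ i
    extends? : (κ′ : Fin j → Fin m) (κ : Fin k → Fin m) → Dec (∀ v → κ′ (e v) ≡ κ v)
    extends? κ′ κ = all? λ v → κ′ (e v) ≟ κ v
    swap-roles : ∀ {κ κ′} → (X κ × ∀ i → κ (s i) ≡ κ′ i) ⇔ (Y κ′ × ∀ v → κ′ (e v) ≡ κ v)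
    swap-roles {κ} {κ′} = mk⇔
      (λ (x , r) → let (y , h) = to (X⇔ κ) x in Y-resp r y , λ v → trans (sym (r (e v))) (h v))
      (λ (y , r′) → let r = λ i → trans (sym (r′ (s i))) (cong κ′ (e∘s i)) in
                    from (X⇔ κ) (Y-resp (λ i → sym (r i)) y ,
                                 λ v → trans (sym (r′ (s (e v)))) (trans (cong κ′ (e∘s (e v))) (r′ v))) , r)

==⇔≡ : {i j : Fin n} → T (i == j) ⇔ (i ≡ j)
==⇔≡ {i = i} {j} = mk⇔ (toℕ-injective ∘ ≡ᵇ⇒≡ (toℕ i) (toℕ j)) (≡⇒≡ᵇ (toℕ i) (toℕ j) ∘ cong toℕ)

if==-⟦≟⟧ : (i j : Fin n) (w : ℕ) → (if i == j then w else 0) ≡ ⟦ i ≟ j ⟧ * w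
if==-⟦≟⟧ i j w with i ≟ j | i == j in eq
... | yes _   | true  = sym (+-identityʳ w)
... | no  _   | false = refl
... | yes i≡j | false = contradiction (from ==⇔≡ i≡j) (subst T eq)
... | no  i≢j | true  = contradiction (to ==⇔≡ (subst T (sym eq) _)) i≢j

T-and-tabulate : (p : A → Bool) (g : Fin n → A) → T (and (map p (tabulate g))) ⇔ (∀ i → T (p (g i)))
T-and-tabulate {n = zero}  p g = mk⇔ (λ _ ()) (λ _ → tt)
T-and-tabulate {n = suc n} p g = mk⇔
  (λ t → let (t₀ , t₊) = to T-∧ t in λ { zero → t₀ ; (suc i) → to (T-and-tabulate p (g ∘ suc)) t₊ i })
  (λ h → from T-∧ (h zero , from (T-and-tabulate p (g ∘ suc)) (h ∘ suc)))

T-allFinᵇ : (p : Fin k → Bool) → T (allFinᵇ k p) ⇔ (∀ i → T (p i))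
T-allFinᵇ p = T-and-tabulate p (λ i → i)

countFin-∑ : (p : Fin k → Bool) → countFin k p ≡ ∑[ i < k ] ⟦ T? (p i) ⟧
countFin-∑ {k = k} p = trans (length-filterᵇ p (allFin k)) (∑←-tabulate (λ i → i) (λ i → ⟦ T? (p i) ⟧))

sum-tabulate : (g : Fin n → ℕ) → sum (tabulate g) ≡ ∑[ i < n ] g i
sum-tabulate g = trans (cong sum (sym (map-id (tabulate g)))) (∑←-tabulate g (λ x → x))

∑⟦⟧-positive : {P : Fin k → Set} (P? : ∀ i → Dec (P i)) → 0 < ∑[ i < k ] ⟦ P? i ⟧ ⇔ ∃ P
∑⟦⟧-positive {k = zero}  P? = mk⇔ (λ ()) (λ ())
∑⟦⟧-positive {k = suc k} P? with P? zero
... | yes p₀ = mk⇔ (λ _ → zero , p₀) (λ _ → s≤s z≤n)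
... | no ¬p₀ = mk⇔ (λ pos → let (i , p) = to (∑⟦⟧-positive (P? ∘ suc)) pos in suc i , p)
                    λ { (zero , p₀) → contradiction p₀ ¬p₀ ; (suc i , p) → from (∑⟦⟧-positive (P? ∘ suc)) (i , p) }

countFin-positive : (p : Fin k → Bool) → T (not (countFin k p ≡ᵇ 0)) ⇔ ∃ λ i → T (p i)
countFin-positive p = subst (λ x → T (not (x ≡ᵇ 0)) ⇔ (∃ λ i → T (p i))) (sym (countFin-∑ p))
                            (∑⟦⟧-positive (T? ∘ p) ⇔-∘ T-not-≡ᵇ0 _)

if-then-1-else-0 : (b : Bool) → (if b then 1 else 0) ≡ ⟦ T? b ⟧
if-then-1-else-0 true  = refl
if-then-1-else-0 false = refl

T-==ℓ : (xs ys : List ℕ) → T (xs ==ℓ ys) ⇔ (xs ≡ ys)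
T-==ℓ []       []       = mk⇔ (λ _ → refl) (λ _ → tt)
T-==ℓ []       (_ ∷ _)  = mk⇔ (λ ()) (λ ())
T-==ℓ (_ ∷ _)  []       = mk⇔ (λ ()) (λ ())
T-==ℓ (x ∷ xs) (y ∷ ys) = mk⇔
  (λ t → let (x=y , xs=ys) = to T-∧ t in cong₂ _∷_ (≡ᵇ⇒≡ x y x=y) (to (T-==ℓ xs ys) xs=ys))
  (λ { refl → from T-∧ (≡⇒≡ᵇ x x refl , from (T-==ℓ xs xs) refl) })

-- Kernels

SameKernel : (Fin k → Fin a) → (Fin k → Fin b) → Set
SameKernel f g = ∀ u v → (f u ≡ f v) ⇔ (g u ≡ g v)

sameKernel? : (f : Fin k → Fin a) (g : Fin k → Fin b) → Dec (SameKernel f g)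
sameKernel? f g = all? λ u → all? λ v → (f u ≟ f v) ⇔-dec (g u ≟ g v)

SameKernel-sym : {f : Fin k → Fin a} {g : Fin k → Fin b} → SameKernel f g → SameKernel g f
SameKernel-sym f~g u v = ⇔-sym (f~g u v)

SameKernel-tail : {f : Fin (suc k) → Fin a} {g : Fin (suc k) → Fin b} →
                  SameKernel f g → SameKernel (tail f) (tail g)
SameKernel-tail f~g u v = f~g (suc u) (suc v)

Image : (Fin k → Fin a) → Fin a → Set
Image f c = ∃ λ v → f v ≡ c

image? : (f : Fin k → Fin a) (c : Fin a) → Dec (Image f c)
image? f c = any? λ v → f v ≟ c

#classes : (Fin k → Fin a) → ℕ
#classes {zero}  f = 0
#classes {suc k} f = ⟦ ¬? (image? (tail f) (f zero)) ⟧ + #classes (tail f)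

#classes-cong : {f : Fin k → Fin a} {g : Fin k → Fin b} → SameKernel f g → #classes f ≡ #classes g
#classes-cong {zero}  f~g = refl
#classes-cong {suc k} f~g = cong₂ _+_
  (⟦⟧-cong (mk⇔ (λ ¬i (v , e) → ¬i (v , from (f~g (suc v) zero) e)) (λ ¬i (v , e) → ¬i (v , to (f~g (suc v) zero) e))))
  (#classes-cong (SameKernel-tail f~g))

#classes≤ : (f : Fin k → Fin a) → #classes f ≤ k
#classes≤ {zero}  f = z≤n
#classes≤ {suc k} f = +-mono-≤ (⟦⟧≤1 (¬? (image? (tail f) (f zero)))) (#classes≤ (tail f))

#classes-positive : (f : Fin k → Fin a) → Fin k → 1 ≤ #classes f
#classes-positive f zero    with image? (tail f) (f zero)
... | yes (v , _) = #classes-positive (tail f) v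
... | no  _       = s≤s z≤n
#classes-positive f (suc v) with image? (tail f) (f zero)
... | yes _ = #classes-positive (tail f) v
... | no  _ = s≤s z≤n

∑-image : (f : Fin k → Fin a) → ∑[ c < a ] ⟦ image? f c ⟧ ≡ #classes f
∑-image {zero}  {a} f = sum-replicate-zero a
∑-image {suc k} {a} f = begin
  ∑[ c < a ] ⟦ image? f c ⟧
    ≡⟨ sum-cong-≗ (λ c → trans (⟦⟧-cong {Q? = (f zero ≟ c) ⊎-dec image? (tail f) c} image-cons)
                               (⟦⟧-⊎ (f zero ≟ c) (image? (tail f) c))) ⟩
  ∑[ c < a ] (⟦ image? (tail f) c ⟧ + ⟦ f zero ≟ c ⟧ * ⟦ ¬? (image? (tail f) c) ⟧)
    ≡⟨ ∑-distrib-+ (λ c → ⟦ image? (tail f) c ⟧) (λ c → ⟦ f zero ≟ c ⟧ * ⟦ ¬? (image? (tail f) c) ⟧) ⟩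
  ∑[ c < a ] ⟦ image? (tail f) c ⟧ + ∑[ c < a ] (⟦ f zero ≟ c ⟧ * ⟦ ¬? (image? (tail f) c) ⟧)
    ≡⟨ cong₂ _+_ (∑-image (tail f)) (∑-δ′ (f zero) _) ⟩
  #classes (tail f) + ⟦ ¬? (image? (tail f) (f zero)) ⟧
    ≡⟨ +-comm (#classes (tail f)) _ ⟩
  #classes f ∎
  where
  open ≡-Reasoning
  image-cons : ∀ {c} → Image f c ⇔ (f zero ≡ c ⊎ Image (tail f) c)
  image-cons = mk⇔ (λ { (zero , e) → inj₁ e ; (suc v , e) → inj₂ (v , e) })
                   (λ { (inj₁ e) → zero , e ; (inj₂ (v , e)) → suc v , e })

-- Counting maps with a prescribed kernel

∣_∣ : (Fin a → Bool) → ℕ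
∣_∣ {a} A = ∑[ c < a ] ⟦ T? (A c) ⟧

∑-avoiding-image : (A : Fin a → Bool) (f : Fin k → Fin a) → (∀ v → T (A (f v))) →
                   ∑[ c < a ] ⟦ T? (A c) ×-dec ¬? (image? f c) ⟧ ≡ ∣ A ∣ ∸ #classes f
∑-avoiding-image {a} A f f∈A = begin
  ∑[ c < a ] ⟦ T? (A c) ×-dec ¬? (image? f c) ⟧
    ≡⟨ m+n∸n≡m _ (#classes f) ⟨
  ∑[ c < a ] ⟦ T? (A c) ×-dec ¬? (image? f c) ⟧ + #classes f ∸ #classes f
    ≡⟨ cong (λ x → ∑[ c < a ] ⟦ T? (A c) ×-dec ¬? (image? f c) ⟧ + x ∸ #classes f) (sym (∑-image f)) ⟩
  ∑[ c < a ] ⟦ T? (A c) ×-dec ¬? (image? f c) ⟧ + ∑[ c < a ] ⟦ image? f c ⟧ ∸ #classes f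
    ≡⟨ cong (_∸ #classes f) (sym (∑-distrib-+ (λ c → ⟦ T? (A c) ×-dec ¬? (image? f c) ⟧) _)) ⟩
  ∑[ c < a ] (⟦ T? (A c) ×-dec ¬? (image? f c) ⟧ + ⟦ image? f c ⟧) ∸ #classes f
    ≡⟨ cong (_∸ #classes f) (sum-cong-≗ λ c →
         trans (cong (⟦ T? (A c) ×-dec ¬? (image? f c) ⟧ +_)
                     (⟦⟧-cong {P? = image? f c} {Q? = T? (A c) ×-dec image? f c}
                              (mk⇔ (λ (v , e) → subst (T ∘ A) e (f∈A v) , v , e) proj₂)))
               (sym (⟦⟧-split (T? (A c)) (image? f c)))) ⟩
  ∣ A ∣ ∸ #classes f ∎
  where open ≡-Reasoning

NonEmpty : (Fin k → Bool) → Set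
NonEmpty Z = ∃ λ v → T (Z v)

nonEmpty? : (Z : Fin k → Bool) → Dec (NonEmpty Z)
nonEmpty? Z = any? (T? ∘ Z)

ConstantOn : (Fin k → Bool) → (Fin k → Fin b) → Set
ConstantOn Z κ = ∀ u v → T (Z u) → T (Z v) → κ u ≡ κ v

constantOn? : (Z : Fin k → Bool) (κ : Fin k → Fin b) → Dec (ConstantOn Z κ)
constantOn? Z κ = all? λ u → all? λ v → T? (Z u) →-dec T? (Z v) →-dec κ u ≟ κ v

ConstantOn-transfer : {Z : Fin k → Bool} {Z′ : Fin m → Bool} {κ : Fin k → Fin b} {κ′ : Fin m → Fin b} →
                      (∀ u → T (Z u) → ∃ λ u′ → T (Z′ u′) × κ′ u′ ≡ κ u) →
                      ConstantOn Z′ κ′ → ConstantOn Z κ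
ConstantOn-transfer rep const u v zu zv =
  let (u′ , zu′ , κu′≡κu) = rep u zu
      (v′ , zv′ , κv′≡κv) = rep v zv
  in trans (sym κu′≡κu) (trans (const u′ v′ zu′ zv′) κv′≡κv)

-- Z is the set of vertices forced onto the looped vertex zero. The set A of allowed
-- values generalizes the count for the induction: once a new class is sent to zero,
-- the remaining classes must avoid zero.
KernelMap : (Fin (suc n) → Bool) → (Fin k → Fin b) → (Fin k → Bool) → (Fin k → Fin (suc n)) → Set
KernelMap A κ Z f = (∀ v → T (A (f v))) × SameKernel κ f × (∀ v → T (Z v) → f v ≡ zero)

kernelMap? : ∀ A (κ : Fin k → Fin b) Z (f : Fin k → Fin (suc n)) → Dec (KernelMap A κ Z f)
kernelMap? A κ Z f = all? (λ v → T? (A (f v))) ×-dec sameKernel? κ f ×-dec all? (λ v → T? (Z v) →-dec f v ≟ zero)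

#kernelMaps : (Fin (suc n) → Bool) → (Fin k → Fin b) → (Fin k → Bool) → ℕ
#kernelMaps {n} {k} A κ Z = ∑[ f ← funs k (allFin (suc n)) ] ⟦ kernelMap? A κ Z f ⟧

HeadFits : (Fin (suc n) → Bool) → (Fin (suc k) → Fin b) → (Fin (suc k) → Bool) →
           Fin (suc n) → (Fin k → Fin (suc n)) → Set
HeadFits A κ Z c f = T (A c) × (∀ v → (κ zero ≡ κ (suc v)) ⇔ (c ≡ f v)) × (T (Z zero) → c ≡ zero)

headFits? : ∀ A (κ : Fin (suc k) → Fin b) Z c (f : Fin k → Fin (suc n)) → Dec (HeadFits A κ Z c f)
headFits? A κ Z c f =
  T? (A c) ×-dec all? (λ v → (κ zero ≟ κ (suc v)) ⇔-dec (c ≟ f v)) ×-dec (T? (Z zero) →-dec c ≟ zero)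

KernelMap-cons : {A : Fin (suc n) → Bool} {κ : Fin (suc k) → Fin b} {Z : Fin (suc k) → Bool} → ∀ {c f} →
                 KernelMap A κ Z (c ∷ᶠ f) ⇔ (KernelMap A (tail κ) (tail Z) f × HeadFits A κ Z c f)
KernelMap-cons {A = A} {κ} {Z} {c} {f} = mk⇔
  (λ (inA , κ~f , z) → (inA ∘ suc , SameKernel-tail κ~f , z ∘ suc) , inA zero , κ~f zero ∘ suc , z zero)
  (λ ((inA , κ~f , z) , a , fits , z₀) →
     (λ { zero → a ; (suc v) → inA v }) , kernel κ~f fits , λ { zero → z₀ ; (suc v) → z v })
  where
  kernel : SameKernel (tail κ) f → (∀ v → (κ zero ≡ κ (suc v)) ⇔ (c ≡ f v)) → SameKernel κ (c ∷ᶠ f)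
  kernel κ~f fits zero    zero    = mk⇔ (λ _ → refl) (λ _ → refl)
  kernel κ~f fits zero    (suc v) = fits v
  kernel κ~f fits (suc u) zero    = ≡-sym-⇔ ⇔-∘ (fits u ⇔-∘ ≡-sym-⇔)
  kernel κ~f fits (suc u) (suc v) = κ~f u v

#kernelMaps-suc : (A : Fin (suc n) → Bool) (κ : Fin (suc k) → Fin b) (Z : Fin (suc k) → Bool) →
                  #kernelMaps A κ Z ≡
                  ∑[ f ← funs k (allFin (suc n)) ] (⟦ kernelMap? A (tail κ) (tail Z) f ⟧ * ∑[ c < suc n ] ⟦ headFits? A κ Z c f ⟧)
#kernelMaps-suc {n} {k} A κ Z = begin
  #kernelMaps A κ Z
    ≡⟨ ∑-funs-suc {k = k} (allFin (suc n)) (λ f → ⟦ kernelMap? A κ Z f ⟧) ⟩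
  ∑[ c ← allFin (suc n) ] ∑[ f ← Fs ] ⟦ kernelMap? A κ Z (c ∷ᶠ f) ⟧
    ≡⟨ ∑←-cong (allFin (suc n)) (λ c → ∑←-cong Fs λ f →
         trans (⟦⟧-cong KernelMap-cons) (⟦⟧-× (kernelMap? A (tail κ) (tail Z) f) (headFits? A κ Z c f))) ⟩
  ∑[ c ← allFin (suc n) ] ∑[ f ← Fs ] (tailFits f * headFits c f)
    ≡⟨ ∑←-comm (allFin (suc n)) Fs (λ c f → tailFits f * headFits c f) ⟩
  ∑[ f ← Fs ] ∑[ c ← allFin (suc n) ] (tailFits f * headFits c f)
    ≡⟨ ∑←-cong Fs (λ f → sym (*-distribˡ-∑← (tailFits f) (allFin (suc n)) (λ c → headFits c f))) ⟩
  ∑[ f ← Fs ] (tailFits f * ∑[ c ← allFin (suc n) ] headFits c f)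
    ≡⟨ ∑←-cong Fs (λ f → cong (tailFits f *_) (∑←-tabulate (λ c → c) (λ c → headFits c f))) ⟩
  ∑[ f ← Fs ] (tailFits f * ∑[ c < suc n ] headFits c f) ∎
  where
  open ≡-Reasoning
  Fs = funs k (allFin (suc n))
  tailFits : (Fin k → Fin (suc n)) → ℕ
  tailFits f = ⟦ kernelMap? A (tail κ) (tail Z) f ⟧
  headFits : Fin (suc n) → (Fin k → Fin (suc n)) → ℕ
  headFits c f = ⟦ headFits? A κ Z c f ⟧

-- If vertex zero lies in the class of v₀, the constraint on vertex zero may be put on v₀.
relocateHead : (Fin (suc k) → Bool) → Fin k → Fin k → Bool
relocateHead Z v₀ v = Z (suc v) ∨ (Z zero ∧ v == v₀)

T-relocateHead : (Z : Fin (suc k) → Bool) (v₀ : Fin k) {v : Fin k} →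
                 T (relocateHead Z v₀ v) ⇔ (T (Z (suc v)) ⊎ (T (Z zero) × v ≡ v₀))
T-relocateHead Z v₀ = mk⇔
  (λ t → map₂ (λ t′ → let (z₀ , v=v₀) = to T-∧ t′ in z₀ , to ==⇔≡ v=v₀) (to T-∨ t))
  (λ s → from T-∨ (map₂ (λ (z₀ , v≡v₀) → from T-∧ (z₀ , from ==⇔≡ v≡v₀)) s))

dropZero : (Fin (suc n) → Bool) → Fin (suc n) → Bool
dropZero A zero    = false
dropZero A (suc c) = A (suc c)

T-dropZero : (A : Fin (suc n) → Bool) {c : Fin (suc n)} → T (dropZero A c) ⇔ (T (A c) × c ≢ zero)
T-dropZero A {zero}  = mk⇔ (λ ()) (λ (_ , c≢0) → c≢0 refl)
T-dropZero A {suc c} = mk⇔ (λ a → a , λ ()) proj₁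

∣dropZero∣ : (A : Fin (suc n) → Bool) → T (A zero) → ∣ dropZero A ∣ ≡ ∣ A ∣ ∸ 1
∣dropZero∣ A a₀ rewrite ⟦⟧-yes (T? (A zero)) a₀ = refl

module _ (A : Fin (suc n) → Bool) (κ : Fin (suc k) → Fin b) (Z : Fin (suc k) → Bool) where

  private
    Fs = funs k (allFin (suc n))

  #kernelMaps-old : (v₀ : Fin k) → κ (suc v₀) ≡ κ zero →
                    #kernelMaps A κ Z ≡ #kernelMaps A (tail κ) (relocateHead Z v₀)
  #kernelMaps-old v₀ κv₀≡κ₀ = trans (#kernelMaps-suc A κ Z) (∑←-cong Fs λ f → begin
    ⟦ kernelMap? A (tail κ) (tail Z) f ⟧ * ∑[ c < suc n ] ⟦ headFits? A κ Z c f ⟧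
      ≡⟨ ⟦⟧*-cong (kernelMap? A (tail κ) (tail Z) f) (λ km → trans
           (sum-cong-≗ λ c → trans (⟦⟧-cong {P? = headFits? A κ Z c f} (HeadFits-old km)) (⟦⟧-× (f v₀ ≟ c) (v₀-allowed f)))
           (∑-δ′ (f v₀) λ _ → ⟦ v₀-allowed f ⟧)) ⟩
    ⟦ kernelMap? A (tail κ) (tail Z) f ⟧ * ⟦ v₀-allowed f ⟧
      ≡⟨ ⟦⟧-× (kernelMap? A (tail κ) (tail Z) f) (v₀-allowed f) ⟨
    ⟦ kernelMap? A (tail κ) (tail Z) f ×-dec v₀-allowed f ⟧
      ≡⟨ ⟦⟧-cong KernelMap-relocateHead ⟩
    ⟦ kernelMap? A (tail κ) (relocateHead Z v₀) f ⟧ ∎)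
    where
    open ≡-Reasoning
    v₀-allowed : (f : Fin k → Fin (suc n)) → Dec (T (Z zero) → f v₀ ≡ zero)
    v₀-allowed f = T? (Z zero) →-dec f v₀ ≟ zero
    HeadFits-old : ∀ {c f} → KernelMap A (tail κ) (tail Z) f →
                   HeadFits A κ Z c f ⇔ (f v₀ ≡ c × (T (Z zero) → f v₀ ≡ zero))
    HeadFits-old {c} {f} (inA , κ~f , _) = mk⇔
      (λ (_ , fits , z₀) → let c≡fv₀ = to (fits v₀) (sym κv₀≡κ₀) in sym c≡fv₀ , λ z → trans (sym c≡fv₀) (z₀ z))
      (λ (fv₀≡c , z₀) → subst (T ∘ A) fv₀≡c (inA v₀) ,
         (λ v → mk⇔ (λ κ₀≡κv → trans (sym fv₀≡c) (to (κ~f v₀ v) (trans κv₀≡κ₀ κ₀≡κv)))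
                    (λ c≡fv → trans (sym κv₀≡κ₀) (from (κ~f v₀ v) (trans fv₀≡c c≡fv)))) ,
         λ z → trans (sym fv₀≡c) (z₀ z))
    KernelMap-relocateHead : ∀ {f} → (KernelMap A (tail κ) (tail Z) f × (T (Z zero) → f v₀ ≡ zero)) ⇔
                                     KernelMap A (tail κ) (relocateHead Z v₀) f
    KernelMap-relocateHead {f} = mk⇔
      (λ ((inA , κ~f , z) , z₀) → inA , κ~f , λ v z′ → case to (T-relocateHead Z v₀) z′ of λ
         { (inj₁ zv) → z v zv ; (inj₂ (z0 , refl)) → z₀ z0 })
      (λ (inA , κ~f , z) → (inA , κ~f , λ v zv → z v (from (T-relocateHead Z v₀) (inj₁ zv))) ,
                           λ z₀ → z v₀ (from (T-relocateHead Z v₀) (inj₂ (z₀ , refl))))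

  HeadFits-new : ¬ Image (tail κ) (κ zero) → ∀ {c f} →
                 HeadFits A κ Z c f ⇔ (T (A c) × ¬ Image f c × (T (Z zero) → c ≡ zero))
  HeadFits-new fresh = mk⇔
    (λ (a , fits , z₀) → a , (λ (v , fv≡c) → fresh (v , sym (from (fits v) (sym fv≡c)))) , z₀)
    (λ (a , ∉f , z₀) → a , (λ v → mk⇔ (λ κ₀≡κv → contradiction (v , sym κ₀≡κv) fresh)
                                      (λ c≡fv → contradiction (v , sym c≡fv) ∉f)) , z₀)

  #kernelMaps-new-free : ¬ Image (tail κ) (κ zero) → ¬ T (Z zero) →
                         #kernelMaps A κ Z ≡ #kernelMaps A (tail κ) (tail Z) * (∣ A ∣ ∸ #classes (tail κ))
  #kernelMaps-new-free fresh z₀ = begin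
    #kernelMaps A κ Z
      ≡⟨ #kernelMaps-suc A κ Z ⟩
    ∑[ f ← Fs ] (⟦ kernelMap? A (tail κ) (tail Z) f ⟧ * ∑[ c < suc n ] ⟦ headFits? A κ Z c f ⟧)
      ≡⟨ ∑←-cong Fs (λ f → ⟦⟧*-cong (kernelMap? A (tail κ) (tail Z) f) λ (inA , κ~f , _) → begin
           ∑[ c < suc n ] ⟦ headFits? A κ Z c f ⟧
             ≡⟨ sum-cong-≗ (λ c → ⟦⟧-cong {P? = headFits? A κ Z c f} {Q? = T? (A c) ×-dec ¬? (image? f c)}
                                    (mk⇔ (λ (a , ∉f , _) → a , ∉f) (λ (a , ∉f) → a , ∉f , ⊥-elim ∘ z₀)
                                     ⇔-∘ HeadFits-new fresh)) ⟩
           ∑[ c < suc n ] ⟦ T? (A c) ×-dec ¬? (image? f c) ⟧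
             ≡⟨ ∑-avoiding-image A f inA ⟩
           ∣ A ∣ ∸ #classes f
             ≡⟨ cong (∣ A ∣ ∸_) (#classes-cong (SameKernel-sym κ~f)) ⟩
           ∣ A ∣ ∸ #classes (tail κ) ∎) ⟩
    ∑[ f ← Fs ] (⟦ kernelMap? A (tail κ) (tail Z) f ⟧ * (∣ A ∣ ∸ #classes (tail κ)))
      ≡⟨ sym (*-distribʳ-∑← (∣ A ∣ ∸ #classes (tail κ)) Fs (λ f → ⟦ kernelMap? A (tail κ) (tail Z) f ⟧)) ⟩
    #kernelMaps A (tail κ) (tail Z) * (∣ A ∣ ∸ #classes (tail κ)) ∎
    where open ≡-Reasoning

  #kernelMaps-new-zero : ¬ Image (tail κ) (κ zero) → T (Z zero) →
                         #kernelMaps A κ Z ≡ ⟦ T? (A zero) ⟧ * #kernelMaps (dropZero A) (tail κ) (tail Z)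
  #kernelMaps-new-zero fresh z₀ = begin
    #kernelMaps A κ Z
      ≡⟨ #kernelMaps-suc A κ Z ⟩
    ∑[ f ← Fs ] (⟦ kernelMap? A (tail κ) (tail Z) f ⟧ * ∑[ c < suc n ] ⟦ headFits? A κ Z c f ⟧)
      ≡⟨ ∑←-cong Fs (λ f → cong (⟦ kernelMap? A (tail κ) (tail Z) f ⟧ *_) (trans
           (sum-cong-≗ {n = suc n} λ c → trans (⟦⟧-cong {P? = headFits? A κ Z c f}
                                            {Q? = (c ≟ zero) ×-dec (T? (A zero) ×-dec ¬? (image? f zero))} (HeadFits-zero f))
                                   (⟦⟧-× (c ≟ zero) (T? (A zero) ×-dec ¬? (image? f zero))))
           (∑-δ {n = suc n} zero λ _ → ⟦ T? (A zero) ×-dec ¬? (image? f zero) ⟧))) ⟩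
    ∑[ f ← Fs ] (⟦ kernelMap? A (tail κ) (tail Z) f ⟧ * ⟦ T? (A zero) ×-dec ¬? (image? f zero) ⟧)
      ≡⟨ ∑←-cong Fs (λ f → ⟦⟧*⟦⟧-cong {P? = kernelMap? A (tail κ) (tail Z) f} {Q? = T? (A zero) ×-dec ¬? (image? f zero)}
                                               {R? = T? (A zero)} {S? = kernelMap? (dropZero A) (tail κ) (tail Z) f}
                                               KernelMap-dropZero) ⟩
    ∑[ f ← Fs ] (⟦ T? (A zero) ⟧ * ⟦ kernelMap? (dropZero A) (tail κ) (tail Z) f ⟧)
      ≡⟨ sym (*-distribˡ-∑← ⟦ T? (A zero) ⟧ Fs (λ f → ⟦ kernelMap? (dropZero A) (tail κ) (tail Z) f ⟧)) ⟩
    ⟦ T? (A zero) ⟧ * #kernelMaps (dropZero A) (tail κ) (tail Z) ∎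
    where
    open ≡-Reasoning
    HeadFits-zero : ∀ {c} f → HeadFits A κ Z c f ⇔ (c ≡ zero × T (A zero) × ¬ Image f zero)
    HeadFits-zero f = mk⇔ (λ (a , ∉f , z) → z z₀ , subst (T ∘ A) (z z₀) a , subst (¬_ ∘ Image f) (z z₀) ∉f)
                          (λ { (refl , a , ∉f) → a , ∉f , λ _ → refl })
                      ⇔-∘ HeadFits-new fresh
    KernelMap-dropZero : ∀ {f} → (KernelMap A (tail κ) (tail Z) f × (T (A zero) × ¬ Image f zero)) ⇔
                                 (T (A zero) × KernelMap (dropZero A) (tail κ) (tail Z) f)
    KernelMap-dropZero = mk⇔
      (λ ((inA , κ~f , z) , a₀ , ∉f) → a₀ , (λ v → from (T-dropZero A) (inA v , λ e → ∉f (v , e))) , κ~f , z)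
      (λ (a₀ , inA , κ~f , z) → ((λ v → proj₁ (to (T-dropZero A) (inA v))) , κ~f , z) ,
                                a₀ , λ (v , e) → proj₂ (to (T-dropZero A) (inA v)) e)

#classes-old : (κ : Fin (suc k) → Fin b) → Image (tail κ) (κ zero) → #classes κ ≡ #classes (tail κ)
#classes-old κ old = cong (_+ #classes (tail κ)) (⟦⟧-no (¬? (image? (tail κ) (κ zero))) (λ fresh → fresh old))

#classes-new : (κ : Fin (suc k) → Fin b) → ¬ Image (tail κ) (κ zero) → #classes κ ≡ suc (#classes (tail κ))
#classes-new κ fresh = cong (_+ #classes (tail κ)) (⟦⟧-yes (¬? (image? (tail κ) (κ zero))) fresh)

kernelMapCount : (Fin (suc n) → Bool) → ℕ → Dec P → Dec Q → ℕ
kernelMapCount A l (no _)  _       = ∣ A ∣ P′ l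
kernelMapCount A l (yes _) (no _)  = 0
kernelMapCount A l (yes _) (yes _) = ⟦ T? (A zero) ⟧ * ((∣ A ∣ ∸ 1) P′ (l ∸ 1))

kernelMapCount-cong : {P′ Q′ : Set} (A : Fin (suc n) → Bool) (l : ℕ)
                      {P? : Dec P} {Q? : Dec Q} {P′? : Dec P′} {Q′? : Dec Q′} →
                      P ⇔ P′ → Q ⇔ Q′ → kernelMapCount A l P? Q? ≡ kernelMapCount A l P′? Q′?
kernelMapCount-cong A l {yes p} {_}     {no ¬p′} P⇔P′ _ = contradiction (to P⇔P′ p) ¬p′
kernelMapCount-cong A l {no ¬p} {_}     {yes p′} P⇔P′ _ = contradiction (from P⇔P′ p′) ¬p
kernelMapCount-cong A l {no _}  {_}     {no _}   _    _ = refl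
kernelMapCount-cong A l {yes _} {yes q} {yes _} {no ¬q′} _ Q⇔Q′ = contradiction (to Q⇔Q′ q) ¬q′
kernelMapCount-cong A l {yes _} {no ¬q} {yes _} {yes q′} _ Q⇔Q′ = contradiction (from Q⇔Q′ q′) ¬q
kernelMapCount-cong A l {yes _} {yes _} {yes _} {yes _}  _ _    = refl
kernelMapCount-cong A l {yes _} {no _}  {yes _} {no _}   _ _    = refl

kernelMapCount-suc : (A : Fin (suc n) → Bool) (l : ℕ) (P? : Dec P) (Q? : Dec Q) → (P → 1 ≤ l) →
                     kernelMapCount A l P? Q? * (∣ A ∣ ∸ l) ≡ kernelMapCount A (suc l) P? Q?
kernelMapCount-suc A l       (no _)  Q?      _   = *-comm (∣ A ∣ P′ l) _
kernelMapCount-suc A l       (yes _) (no _)  _   = refl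
kernelMapCount-suc A zero    (yes p) (yes _) l>0 = contradiction (l>0 p) λ ()
kernelMapCount-suc A (suc l) (yes _) (yes _) _   = begin
  ⟦ T? (A zero) ⟧ * ((∣ A ∣ ∸ 1) P′ l) * (∣ A ∣ ∸ suc l)     ≡⟨ *-assoc ⟦ T? (A zero) ⟧ _ _ ⟩
  ⟦ T? (A zero) ⟧ * (((∣ A ∣ ∸ 1) P′ l) * (∣ A ∣ ∸ suc l))
    ≡⟨ cong (⟦ T? (A zero) ⟧ *_) (*-comm ((∣ A ∣ ∸ 1) P′ l) _) ⟩
  ⟦ T? (A zero) ⟧ * ((∣ A ∣ ∸ suc l) * ((∣ A ∣ ∸ 1) P′ l))
    ≡⟨ cong (λ x → ⟦ T? (A zero) ⟧ * (x * ((∣ A ∣ ∸ 1) P′ l))) (∸-+-assoc ∣ A ∣ 1 l) ⟨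
  ⟦ T? (A zero) ⟧ * ((∣ A ∣ ∸ 1) P′ suc l)                   ∎
  where open ≡-Reasoning

module _ (A : Fin (suc n) → Bool) (l : ℕ) where

  kernelMapCount-empty : {P? : Dec P} {Q? : Dec Q} → ¬ P → kernelMapCount A l P? Q? ≡ ∣ A ∣ P′ l
  kernelMapCount-empty {P? = yes p} ¬p = contradiction p ¬p
  kernelMapCount-empty {P? = no _}  _  = refl

  kernelMapCount-scattered : {P? : Dec P} {Q? : Dec Q} → P → ¬ Q → kernelMapCount A l P? Q? ≡ 0
  kernelMapCount-scattered {P? = no ¬p}         p _  = contradiction p ¬p
  kernelMapCount-scattered {P? = yes _} {yes q} _ ¬q = contradiction q ¬q
  kernelMapCount-scattered {P? = yes _} {no _}  _ _  = refl

  kernelMapCount-oneClass : {P? : Dec P} {Q? : Dec Q} → P → Q →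
                            kernelMapCount A l P? Q? ≡ ⟦ T? (A zero) ⟧ * ((∣ A ∣ ∸ 1) P′ (l ∸ 1))
  kernelMapCount-oneClass {P? = no ¬p}          p _ = contradiction p ¬p
  kernelMapCount-oneClass {P? = yes _} {no ¬q}  _ q = contradiction q ¬q
  kernelMapCount-oneClass {P? = yes _} {yes _}  _ _ = refl

kernelMapCount-dropZero : (A : Fin (suc n) → Bool) (l : ℕ) (P? : Dec P) (Q? : Dec Q) → P →
                          kernelMapCount (dropZero A) l P? Q? ≡ 0
kernelMapCount-dropZero A l (no ¬p) Q?      p = contradiction p ¬p
kernelMapCount-dropZero A l (yes _) (no _)  _ = refl
kernelMapCount-dropZero A l (yes _) (yes _) _ = refl

KernelMapFormula : (n : ℕ) → (Fin k → Fin b) → Set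
KernelMapFormula n κ = ∀ (A : Fin (suc n) → Bool) Z →
                       #kernelMaps A κ Z ≡ kernelMapCount A (#classes κ) (nonEmpty? Z) (constantOn? Z κ)

module _ (κ : Fin (suc k) → Fin b) (IH : KernelMapFormula n (tail κ))
         (A : Fin (suc n) → Bool) (Z : Fin (suc k) → Bool) where

  private
    ℓ′ = #classes (tail κ)

  kernelMapFormula-old : Image (tail κ) (κ zero) →
                         #kernelMaps A κ Z ≡ kernelMapCount A (#classes κ) (nonEmpty? Z) (constantOn? Z κ)
  kernelMapFormula-old (v₀ , κv₀≡κ₀) = begin
    #kernelMaps A κ Z
      ≡⟨ #kernelMaps-old A κ Z v₀ κv₀≡κ₀ ⟩
    #kernelMaps A (tail κ) (relocateHead Z v₀)
      ≡⟨ IH A (relocateHead Z v₀) ⟩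
    kernelMapCount A ℓ′ (nonEmpty? (relocateHead Z v₀)) (constantOn? (relocateHead Z v₀) (tail κ))
      ≡⟨ kernelMapCount-cong A ℓ′ {P? = nonEmpty? (relocateHead Z v₀)} {constantOn? (relocateHead Z v₀) (tail κ)}
                             {nonEmpty? Z} {constantOn? Z κ}
                             nonEmpty⇔ (mk⇔ (ConstantOn-transfer rep) (ConstantOn-transfer rep′)) ⟩
    kernelMapCount A ℓ′ (nonEmpty? Z) (constantOn? Z κ)
      ≡⟨ cong (λ l → kernelMapCount A l (nonEmpty? Z) (constantOn? Z κ)) (#classes-old κ (v₀ , κv₀≡κ₀)) ⟨
    kernelMapCount A (#classes κ) (nonEmpty? Z) (constantOn? Z κ) ∎
    where
    open ≡-Reasoning
    rep : ∀ u → T (Z u) → ∃ λ u′ → T (relocateHead Z v₀ u′) × tail κ u′ ≡ κ u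
    rep zero    z = v₀ , from (T-relocateHead Z v₀) (inj₂ (z , refl)) , κv₀≡κ₀
    rep (suc u) z = u , from (T-relocateHead Z v₀) (inj₁ z) , refl
    rep′ : ∀ u′ → T (relocateHead Z v₀ u′) → ∃ λ u → T (Z u) × κ u ≡ tail κ u′
    rep′ u′ z with to (T-relocateHead Z v₀) z
    ... | inj₁ z₊          = suc u′ , z₊ , refl
    ... | inj₂ (z₀ , refl) = zero , z₀ , sym κv₀≡κ₀
    nonEmpty⇔ : NonEmpty (relocateHead Z v₀) ⇔ NonEmpty Z
    nonEmpty⇔ = mk⇔ (λ (u′ , z) → let (u , zu , _) = rep′ u′ z in u , zu)
                    (λ (u , z) → let (u′ , zu′ , _) = rep u z in u′ , zu′)

  kernelMapFormula-new-free : ¬ Image (tail κ) (κ zero) → ¬ T (Z zero) →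
                              #kernelMaps A κ Z ≡ kernelMapCount A (#classes κ) (nonEmpty? Z) (constantOn? Z κ)
  kernelMapFormula-new-free fresh z₀ = begin
    #kernelMaps A κ Z
      ≡⟨ #kernelMaps-new-free A κ Z fresh z₀ ⟩
    #kernelMaps A (tail κ) (tail Z) * (∣ A ∣ ∸ ℓ′)
      ≡⟨ cong (_* (∣ A ∣ ∸ ℓ′)) (IH A (tail Z)) ⟩
    kernelMapCount A ℓ′ (nonEmpty? (tail Z)) (constantOn? (tail Z) (tail κ)) * (∣ A ∣ ∸ ℓ′)
      ≡⟨ kernelMapCount-suc A ℓ′ (nonEmpty? (tail Z)) _ (λ (v , _) → #classes-positive (tail κ) v) ⟩
    kernelMapCount A (suc ℓ′) (nonEmpty? (tail Z)) (constantOn? (tail Z) (tail κ))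
      ≡⟨ kernelMapCount-cong A (suc ℓ′) {P? = nonEmpty? (tail Z)} {constantOn? (tail Z) (tail κ)}
                                   {nonEmpty? Z} {constantOn? Z κ} nonEmpty⇔
           (mk⇔ (ConstantOn-transfer rep) (ConstantOn-transfer λ u z → suc u , z , refl)) ⟩
    kernelMapCount A (suc ℓ′) (nonEmpty? Z) (constantOn? Z κ)
      ≡⟨ cong (λ l → kernelMapCount A l (nonEmpty? Z) (constantOn? Z κ)) (#classes-new κ fresh) ⟨
    kernelMapCount A (#classes κ) (nonEmpty? Z) (constantOn? Z κ) ∎
    where
    open ≡-Reasoning
    rep : ∀ u → T (Z u) → ∃ λ u′ → T (tail Z u′) × tail κ u′ ≡ κ u
    rep zero    z = contradiction z z₀
    rep (suc u) z = u , z , refl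
    nonEmpty⇔ : NonEmpty (tail Z) ⇔ NonEmpty Z
    nonEmpty⇔ = mk⇔ (λ (v , z) → suc v , z) (λ (u , z) → let (u′ , z′ , _) = rep u z in u′ , z′)

  kernelMapFormula-new-zero : ¬ Image (tail κ) (κ zero) → T (Z zero) →
                              #kernelMaps A κ Z ≡ kernelMapCount A (#classes κ) (nonEmpty? Z) (constantOn? Z κ)
  kernelMapFormula-new-zero fresh z₀ = begin
    #kernelMaps A κ Z
      ≡⟨ #kernelMaps-new-zero A κ Z fresh z₀ ⟩
    ⟦ T? (A zero) ⟧ * #kernelMaps (dropZero A) (tail κ) (tail Z)
      ≡⟨ cong (⟦ T? (A zero) ⟧ *_) (IH (dropZero A) (tail Z)) ⟩
    ⟦ T? (A zero) ⟧ * kernelMapCount (dropZero A) ℓ′ (nonEmpty? (tail Z)) (constantOn? (tail Z) (tail κ))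
      ≡⟨ byRest (nonEmpty? (tail Z)) ⟩
    kernelMapCount A (suc ℓ′) (nonEmpty? Z) (constantOn? Z κ)
      ≡⟨ cong (λ l → kernelMapCount A l (nonEmpty? Z) (constantOn? Z κ)) (#classes-new κ fresh) ⟨
    kernelMapCount A (#classes κ) (nonEmpty? Z) (constantOn? Z κ) ∎
    where
    open ≡-Reasoning
    byRest : Dec (NonEmpty (tail Z)) →
             ⟦ T? (A zero) ⟧ * kernelMapCount (dropZero A) ℓ′ (nonEmpty? (tail Z)) (constantOn? (tail Z) (tail κ))
             ≡ kernelMapCount A (suc ℓ′) (nonEmpty? Z) (constantOn? Z κ)
    byRest (yes (v , z)) = begin
      ⟦ T? (A zero) ⟧ * kernelMapCount (dropZero A) ℓ′ (nonEmpty? (tail Z)) (constantOn? (tail Z) (tail κ))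
        ≡⟨ cong (⟦ T? (A zero) ⟧ *_) (kernelMapCount-dropZero A ℓ′ (nonEmpty? (tail Z)) (constantOn? (tail Z) (tail κ)) (v , z)) ⟩
      ⟦ T? (A zero) ⟧ * 0
        ≡⟨ *-zeroʳ ⟦ T? (A zero) ⟧ ⟩
      0
        ≡⟨ kernelMapCount-scattered A (suc ℓ′) {P? = nonEmpty? Z} {Q? = constantOn? Z κ} (zero , z₀)
                                    (λ const → fresh (v , sym (const zero (suc v) z₀ z))) ⟨
      kernelMapCount A (suc ℓ′) (nonEmpty? Z) (constantOn? Z κ) ∎
    byRest (no empty) = begin
      ⟦ T? (A zero) ⟧ * kernelMapCount (dropZero A) ℓ′ (nonEmpty? (tail Z)) (constantOn? (tail Z) (tail κ))
        ≡⟨ cong (⟦ T? (A zero) ⟧ *_)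
                (kernelMapCount-empty (dropZero A) ℓ′ {P? = nonEmpty? (tail Z)} {constantOn? (tail Z) (tail κ)} empty) ⟩
      ⟦ T? (A zero) ⟧ * (∣ dropZero A ∣ P′ ℓ′)
        ≡⟨ ⟦⟧*-cong (T? (A zero)) (λ a₀ → cong (_P′ ℓ′) (∣dropZero∣ A a₀)) ⟩
      ⟦ T? (A zero) ⟧ * ((∣ A ∣ ∸ 1) P′ ℓ′)
        ≡⟨ kernelMapCount-oneClass A (suc ℓ′) {P? = nonEmpty? Z} {Q? = constantOn? Z κ} (zero , z₀) onlyZero ⟨
      kernelMapCount A (suc ℓ′) (nonEmpty? Z) (constantOn? Z κ) ∎
      where
      onlyZero : ConstantOn Z κ
      onlyZero zero    zero    _  _  = refl
      onlyZero zero    (suc v) _  zv = contradiction (v , zv) empty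
      onlyZero (suc u) _       zu _  = contradiction (u , zu) empty

#kernelMaps-formula : (κ : Fin k → Fin b) → KernelMapFormula n κ
#kernelMaps-formula {k = zero}  κ A Z = refl
#kernelMaps-formula {k = suc k} κ A Z = byHead (image? (tail κ) (κ zero)) (T? (Z zero))
  where
  byHead : Dec (Image (tail κ) (κ zero)) → Dec (T (Z zero)) →
           #kernelMaps A κ Z ≡ kernelMapCount A (#classes κ) (nonEmpty? Z) (constantOn? Z κ)
  byHead (yes old)   _        = kernelMapFormula-old κ (#kernelMaps-formula (tail κ)) A Z old
  byHead (no  fresh) (no  z₀) = kernelMapFormula-new-free κ (#kernelMaps-formula (tail κ)) A Z fresh z₀
  byHead (no  fresh) (yes z₀) = kernelMapFormula-new-zero κ (#kernelMaps-formula (tail κ)) A Z fresh z₀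

[n∸k]!*nP′k≡n! : {n k : ℕ} → k ≤ n → (n ∸ k) ! * (n P′ k) ≡ n !
[n∸k]!*nP′k≡n! {n} {zero}  _   = *-identityʳ (n !)
[n∸k]!*nP′k≡n! {n} {suc k} k<n = begin
  (n ∸ suc k) ! * ((n ∸ k) * (n P′ k))   ≡⟨ *-left-comm ((n ∸ suc k) !) (n ∸ k) (n P′ k) ⟩
  (n ∸ k) * ((n ∸ suc k) ! * (n P′ k))   ≡⟨ *-assoc (n ∸ k) ((n ∸ suc k) !) (n P′ k) ⟨
  (n ∸ k) * (n ∸ suc k) ! * (n P′ k)     ≡⟨ cong (λ x → x * (n ∸ suc k) ! * (n P′ k)) n∸k≡1+n∸[1+k] ⟩
  suc (n ∸ suc k) ! * (n P′ k)           ≡⟨ cong (λ x → x ! * (n P′ k)) n∸k≡1+n∸[1+k] ⟨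
  (n ∸ k) ! * (n P′ k)                   ≡⟨ [n∸k]!*nP′k≡n! (<⇒≤ k<n) ⟩
  n !                                    ∎
  where
  open ≡-Reasoning
  n∸k≡1+n∸[1+k] : n ∸ k ≡ suc (n ∸ suc k)
  n∸k≡1+n∸[1+k] = +-∸-assoc 1 k<n

full : Fin n → Bool
full _ = true

∣full∣ : (n : ℕ) → ∣ full {n} ∣ ≡ n
∣full∣ zero    = refl
∣full∣ (suc n) = cong suc (∣full∣ n)

kernelMapCount-all : (l : ℕ) (P? : Dec P) (Q? : Dec Q) → l ≤ suc n → (P → 1 ≤ l) →
                     (suc n ∸ l) ! * kernelMapCount (full {suc n}) l P? Q? ≡ suc n ! * ⟦ ¬? P? ⟧ + n ! * ⟦ P? ×-dec Q? ⟧
kernelMapCount-all {n = n} l (no _) Q? l≤N _ = begin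
  (suc n ∸ l) ! * (∣ full {suc n} ∣ P′ l)           ≡⟨ cong (λ x → (suc n ∸ l) ! * (x P′ l)) (∣full∣ (suc n)) ⟩
  (suc n ∸ l) ! * (suc n P′ l)             ≡⟨ [n∸k]!*nP′k≡n! l≤N ⟩
  suc n !                                  ≡⟨ *-identityʳ (suc n !) ⟨
  suc n ! * 1                              ≡⟨ +-identityʳ (suc n ! * 1) ⟨
  suc n ! * 1 + 0                          ≡⟨ cong (suc n ! * 1 +_) (*-zeroʳ (n !)) ⟨
  suc n ! * 1 + n ! * 0                    ∎
  where open ≡-Reasoning
kernelMapCount-all {n = n} l (yes _) (no _) _ _ = begin
  (suc n ∸ l) ! * 0          ≡⟨ *-zeroʳ ((suc n ∸ l) !) ⟩
  0                          ≡⟨ cong₂ _+_ (*-zeroʳ (suc n !)) (*-zeroʳ (n !)) ⟨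
  suc n ! * 0 + n ! * 0      ∎
  where open ≡-Reasoning
kernelMapCount-all {n = n} zero    (yes p) (yes _) _ l>0 = contradiction (l>0 p) λ ()
kernelMapCount-all {n = n} (suc l) (yes _) (yes _) (s≤s l≤n) _ = begin
  (n ∸ l) ! * (1 * ((∣ full {suc n} ∣ ∸ 1) P′ l))           ≡⟨ cong (λ x → (n ∸ l) ! * (1 * ((x ∸ 1) P′ l))) (∣full∣ (suc n)) ⟩
  (n ∸ l) ! * (1 * (n P′ l))                      ≡⟨ cong ((n ∸ l) ! *_) (*-identityˡ (n P′ l)) ⟩
  (n ∸ l) ! * (n P′ l)                            ≡⟨ [n∸k]!*nP′k≡n! l≤n ⟩
  n !                                             ≡⟨ *-identityʳ (n !) ⟨
  n ! * 1                                         ≡⟨ cong (_+ n ! * 1) (*-zeroʳ (suc n !)) ⟨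
  suc n ! * 0 + n ! * 1                           ∎
  where open ≡-Reasoning

-- Partitions

mult-cons : (i x : ℕ) (xs : List ℕ) → mult i (x ∷ xs) ≡ ⟦ T? (x ≡ᵇ i) ⟧ + mult i xs
mult-cons i x xs with x ≡ᵇ i
... | true  = refl
... | false = refl

mult-↭ : (i : ℕ) {xs ys : List ℕ} → xs ↭ ys → mult i xs ≡ mult i ys
mult-↭ i xs↭ys = ↭-length (filter-↭ (λ x → T? (x ≡ᵇ i)) xs↭ys)

insertDesc-↭ : (x : ℕ) (ys : List ℕ) → insertDesc x ys ↭ x ∷ ys
insertDesc-↭ x []       = ↭-refl
insertDesc-↭ x (y ∷ ys) with y ≤ᵇ x
... | true  = ↭-refl
... | false = ↭-trans (prep y (insertDesc-↭ x ys)) (swap y x ↭-refl)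

sortDesc-↭ : (xs : List ℕ) → sortDesc xs ↭ xs
sortDesc-↭ []       = ↭-refl
sortDesc-↭ (x ∷ xs) = ↭-trans (insertDesc-↭ x (sortDesc xs)) (prep x (sortDesc-↭ xs))

nonzeros : List ℕ → List ℕ
nonzeros = filterᵇ (λ x → not (x ≡ᵇ 0))

mult-nonzeros : (i : ℕ) (xs : List ℕ) → mult (suc i) (nonzeros xs) ≡ mult (suc i) xs
mult-nonzeros i []           = refl
mult-nonzeros i (zero  ∷ xs) = mult-nonzeros i xs
mult-nonzeros i (suc x ∷ xs) = begin
  mult (suc i) (suc x ∷ nonzeros xs)       ≡⟨ mult-cons (suc i) (suc x) (nonzeros xs) ⟩
  ⟦ T? (x ≡ᵇ i) ⟧ + mult (suc i) (nonzeros xs) ≡⟨ cong (⟦ T? (x ≡ᵇ i) ⟧ +_) (mult-nonzeros i xs) ⟩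
  ⟦ T? (x ≡ᵇ i) ⟧ + mult (suc i) xs         ≡⟨ mult-cons (suc i) (suc x) xs ⟨
  mult (suc i) (suc x ∷ xs)                ∎
  where open ≡-Reasoning

mult-zero-nonzeros : (xs : List ℕ) → mult 0 (nonzeros xs) ≡ 0
mult-zero-nonzeros []           = refl
mult-zero-nonzeros (zero  ∷ xs) = mult-zero-nonzeros xs
mult-zero-nonzeros (suc x ∷ xs) = trans (mult-cons 0 (suc x) (nonzeros xs)) (mult-zero-nonzeros xs)

sum-nonzeros : (xs : List ℕ) → sum (nonzeros xs) ≡ sum xs
sum-nonzeros []           = refl
sum-nonzeros (zero  ∷ xs) = sum-nonzeros xs
sum-nonzeros (suc x ∷ xs) = cong (suc x +_) (sum-nonzeros xs)

mult-partitionOf : (i : ℕ) (xs : List ℕ) → mult (suc i) (partitionOf xs) ≡ mult (suc i) xs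
mult-partitionOf i xs = trans (mult-↭ (suc i) (sortDesc-↭ (nonzeros xs))) (mult-nonzeros i xs)

mult-zero-partitionOf : (xs : List ℕ) → mult 0 (partitionOf xs) ≡ 0
mult-zero-partitionOf xs = trans (mult-↭ 0 (sortDesc-↭ (nonzeros xs))) (mult-zero-nonzeros xs)

sum-partitionOf : (xs : List ℕ) → sum (partitionOf xs) ≡ sum xs
sum-partitionOf xs = trans (sum-↭ (sortDesc-↭ (nonzeros xs))) (sum-nonzeros xs)

length-partitionOf : (xs : List ℕ) → length (partitionOf xs) ≡ length (nonzeros xs)
length-partitionOf xs = ↭-length (sortDesc-↭ (nonzeros xs))

Descending : List ℕ → Set
Descending = AllPairs _≥_

insertDesc-descending : (x : ℕ) {ys : List ℕ} → Descending ys → Descending (insertDesc x ys)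
insertDesc-descending x {[]}     []           = [] ∷ []
insertDesc-descending x {y ∷ ys} (y≥ys ∷ ys↓) with y ≤ᵇ x in y≤ᵇx
... | true  = (y≤x ∷ All.map (λ z≤y → ≤-trans z≤y y≤x) y≥ys) ∷ y≥ys ∷ ys↓
  where y≤x = ≤ᵇ⇒≤ y x (subst T (sym y≤ᵇx) _)
... | false = All-resp-↭ (↭-sym (insertDesc-↭ x ys)) (x≤y ∷ y≥ys) ∷ insertDesc-descending x ys↓
  where x≤y = <⇒≤ (≰⇒> λ y≤x → subst T y≤ᵇx (≤⇒≤ᵇ y≤x))

sortDesc-descending : (xs : List ℕ) → Descending (sortDesc xs)
sortDesc-descending []       = []
sortDesc-descending (x ∷ xs) = insertDesc-descending x (sortDesc-descending xs)

mult-above : {x i : ℕ} {xs : List ℕ} → All (_≤ x) xs → x < i → mult i xs ≡ 0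
mult-above {xs = []}     []          x<i = refl
mult-above {xs = y ∷ ys} (y≤x ∷ ys≤x) x<i = trans (mult-cons _ y ys)
  (cong₂ _+_ (⟦⟧-no (T? (y ≡ᵇ _)) λ y=i → <⇒≢ (≤-<-trans y≤x x<i) (≡ᵇ⇒≡ y _ y=i)) (mult-above ys≤x x<i))

mult-head : (x : ℕ) (xs : List ℕ) → mult x (x ∷ xs) ≡ suc (mult x xs)
mult-head x xs = trans (mult-cons x x xs) (cong (_+ mult x xs) (⟦⟧-yes (T? (x ≡ᵇ x)) (≡⇒≡ᵇ x x refl)))

descending-unique : {xs ys : List ℕ} → Descending xs → Descending ys → (∀ i → mult i xs ≡ mult i ys) → xs ≡ ys
descending-unique []  []  _ = refl
descending-unique []  (_∷_ {y} {ys} _ _) same = contradiction (trans (same y) (mult-head y ys)) λ ()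
descending-unique (_∷_ {x} {xs} _ _) []  same = contradiction (trans (sym (same x)) (mult-head x xs)) λ ()
descending-unique (_∷_ {x} {xs} x≥xs xs↓) (_∷_ {y} {ys} y≥ys ys↓) same with <-cmp x y
... | tri< x<y _ _ = contradiction (trans (same y) (mult-head y ys))
                       (λ e → 1+n≢0 (trans (sym e) (trans (mult-cons y x xs)
                         (cong₂ _+_ (⟦⟧-no (T? (x ≡ᵇ y)) λ x=y → <⇒≢ x<y (≡ᵇ⇒≡ x y x=y)) (mult-above x≥xs x<y)))))
... | tri> _ _ y<x = contradiction (trans (sym (same x)) (mult-head x xs))
                       (λ e → 1+n≢0 (trans (sym e) (trans (mult-cons x y ys)
                         (cong₂ _+_ (⟦⟧-no (T? (y ≡ᵇ x)) λ y=x → <⇒≢ y<x (≡ᵇ⇒≡ y x y=x)) (mult-above y≥ys y<x)))))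
... | tri≈ _ refl _ = cong (x ∷_) (descending-unique xs↓ ys↓ λ i →
                         +-cancelˡ-≡ ⟦ T? (x ≡ᵇ i) ⟧ _ _ (trans (sym (mult-cons i x xs)) (trans (same i) (mult-cons i x ys))))

partitionOf-≡⇔ : (xs ys : List ℕ) → (partitionOf xs ≡ partitionOf ys) ⇔ (∀ i → mult (suc i) xs ≡ mult (suc i) ys)
partitionOf-≡⇔ xs ys = mk⇔
  (λ eq i → trans (sym (mult-partitionOf i xs)) (trans (cong (mult (suc i)) eq) (mult-partitionOf i ys)))
  (λ same → descending-unique (sortDesc-descending (nonzeros xs)) (sortDesc-descending (nonzeros ys)) λ
     { zero    → trans (mult-zero-partitionOf xs) (sym (mult-zero-partitionOf ys))
     ; (suc i) → trans (mult-partitionOf i xs) (trans (same i) (sym (mult-partitionOf i ys))) })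

-- Placing the parts of a composition

#parts : ℕ → (Fin n → ℕ) → ℕ
#parts {n} i c = ∑[ j < n ] ⟦ T? (c j ≡ᵇ i) ⟧

mult-tabulate : (i : ℕ) (c : Fin n → ℕ) → mult i (tabulate c) ≡ #parts i c
mult-tabulate i c = trans (length-filterᵇ (λ x → x ≡ᵇ i) (tabulate c)) (∑←-tabulate c λ x → ⟦ T? (x ≡ᵇ i) ⟧)

SameParts : (Fin m → ℕ) → (Fin n → ℕ) → Set
SameParts α c = ∀ i → #parts (suc i) α ≡ #parts (suc i) c

partitionOf-≡⇔SameParts : (α : Fin m → ℕ) (c : Fin n → ℕ) →
                         (partitionOf (tabulate α) ≡ partitionOf (tabulate c)) ⇔ SameParts α c
partitionOf-≡⇔SameParts α c = mk⇔
  (λ eq i → trans (sym (mult-tabulate (suc i) α)) (trans (to E eq i) (mult-tabulate (suc i) c)))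
  (λ same → from E λ i → trans (mult-tabulate (suc i) α) (trans (same i) (sym (mult-tabulate (suc i) c))))
  where E = partitionOf-≡⇔ (tabulate α) (tabulate c)

sameParts? : (α : Fin m → ℕ) (c : Fin n → ℕ) → Dec (SameParts α c)
sameParts? α c = map′ (to E) (from E) (≡-dec _≟ℕ_ (partitionOf (tabulate α)) (partitionOf (tabulate c)))
  where E = partitionOf-≡⇔SameParts α c

∏! : ℕ → (ℕ → ℕ) → ℕ
∏! B h = product (tabulate {n = B} λ i → h (suc (toℕ i)) !)

∏!-cong : (B : ℕ) {h h′ : ℕ → ℕ} → (∀ i → h (suc i) ≡ h′ (suc i)) → ∏! B h ≡ ∏! B h′
∏!-cong zero    h≗h′ = refl
∏!-cong (suc B) {h} {h′} h≗h′ = cong₂ _*_ (cong _! (h≗h′ 0)) (∏!-cong B {h ∘ suc} {h′ ∘ suc} (h≗h′ ∘ suc))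

∏!-zero : (B : ℕ) → ∏! B (λ _ → 0) ≡ 1
∏!-zero zero    = refl
∏!-zero (suc B) = trans (+-identityʳ _) (∏!-zero B)

∏!-bump : (B x : ℕ) (h : ℕ → ℕ) → x < B →
          ∏! B (λ i → ⟦ T? (suc x ≡ᵇ i) ⟧ + h i) ≡ suc (h (suc x)) * ∏! B h
∏!-bump (suc B) zero    h _ =
  trans (cong (suc (h 1) * h 1 ! *_) (∏!-cong B {λ i → ⟦ T? (0 ≡ᵇ i) ⟧ + h (suc i)} {h ∘ suc} λ _ → refl))
        (*-assoc (suc (h 1)) (h 1 !) (∏! B (h ∘ suc)))
∏!-bump (suc B) (suc x) h (s≤s x<B) = begin
  h 1 ! * ∏! B (λ i → ⟦ T? (suc x ≡ᵇ i) ⟧ + h (suc i)) ≡⟨ cong (h 1 ! *_) (∏!-bump B x (h ∘ suc) x<B) ⟩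
  h 1 ! * (suc (h (suc (suc x))) * ∏! B (h ∘ suc))    ≡⟨ *-left-comm (h 1 !) (suc (h (suc (suc x)))) (∏! B (h ∘ suc)) ⟩
  suc (h (suc (suc x))) * (h 1 ! * ∏! B (h ∘ suc))    ∎
  where open ≡-Reasoning

partsFactorial : ℕ → (Fin n → ℕ) → ℕ
partsFactorial B c = ∏! B λ i → #parts i c

Placement : (Fin n → ℕ) → (Fin n → Fin (suc m)) → Set
Placement c τ = (∀ j → (τ j ≡ zero) ⇔ (c j ≡ 0)) × (∀ i j → τ i ≡ τ j → τ i ≡ zero ⊎ i ≡ j)

placed : (Fin n → Fin (suc m)) → (Fin n → ℕ) → Fin m → ℕ
placed {n} τ c t = ∑[ j < n ] (⟦ τ j ≟ suc t ⟧ * c j)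

Places : (Fin n → ℕ) → (Fin m → ℕ) → (Fin n → Fin (suc m)) → Set
Places c α τ = Placement c τ × (∀ t → placed τ c t ≡ α t)

places? : (c : Fin n → ℕ) (α : Fin m → ℕ) (τ : Fin n → Fin (suc m)) → Dec (Places c α τ)
places? c α τ = (all? (λ j → (τ j ≟ zero) ⇔-dec (c j ≟ℕ 0)) ×-dec
                 all? (λ i → all? λ j → (τ i ≟ τ j) →-dec ((τ i ≟ zero) ⊎-dec (i ≟ j)))) ×-dec
                all? (λ t → placed τ c t ≟ℕ α t)

#placements : (Fin n → ℕ) → (Fin m → ℕ) → ℕ
#placements {n} {m} c α = ∑[ τ ← funs n (allFin (suc m)) ] ⟦ places? c α τ ⟧

module _ {c : Fin (suc n) → ℕ} {o : Fin (suc m)} {τ : Fin n → Fin (suc m)} where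

  Placement-tail : Placement c (o ∷ᶠ τ) → Placement (tail c) τ
  Placement-tail (zeros , inj) = zeros ∘ suc , λ i j τi≡τj → map₂ suc-injective (inj (suc i) (suc j) τi≡τj)

  Placement-cons : ((o ≡ zero) ⇔ (c zero ≡ 0)) → (∀ j → τ j ≡ o → o ≡ zero) →
                   Placement (tail c) τ → Placement c (o ∷ᶠ τ)
  Placement-cons zero₀ fresh (zeros , inj) = (λ { zero → zero₀ ; (suc j) → zeros j }) , injective
    where
    injective : ∀ i j → (o ∷ᶠ τ) i ≡ (o ∷ᶠ τ) j → (o ∷ᶠ τ) i ≡ zero ⊎ i ≡ j
    injective zero    zero    _ = inj₂ refl
    injective zero    (suc j) e = inj₁ (fresh j (sym e))
    injective (suc i) zero    e = inj₁ (trans e (fresh i e))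
    injective (suc i) (suc j) e = map₂ (cong suc) (inj i j e)

module _ (c : Fin (suc n) → ℕ) (α : Fin m → ℕ) (τ : Fin n → Fin (suc m)) where

  Places-emptyHead : c zero ≡ 0 → Places c α (zero ∷ᶠ τ) ⇔ Places (tail c) α τ
  Places-emptyHead c₀≡0 = mk⇔
    (λ (pl , eq) → Placement-tail pl , eq)
    (λ (pl , eq) → Placement-cons (mk⇔ (λ _ → c₀≡0) (λ _ → refl)) (λ _ _ → refl) pl , eq)

  ¬Places-emptyHead : c zero ≡ 0 → (t : Fin m) → ¬ Places c α (suc t ∷ᶠ τ)
  ¬Places-emptyHead c₀≡0 t ((zeros , _) , _) = case from (zeros zero) c₀≡0 of λ ()

  ¬Places-partHead : (x : ℕ) → c zero ≡ suc x → ¬ Places c α (zero ∷ᶠ τ)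
  ¬Places-partHead x c₀≡x+1 ((zeros , _) , _) = case trans (sym c₀≡x+1) (to (zeros zero) refl) of λ ()

  Places-partHead : (x : ℕ) → c zero ≡ suc x → (t : Fin m) →
                    Places c α (suc t ∷ᶠ τ) ⇔ (α t ≡ suc x × Places (tail c) (updateAt α t (λ _ → 0)) τ)
  Places-partHead x c₀≡x+1 t = mk⇔ forward backward
    where
    α′ = updateAt α t (λ _ → 0)
    placed-cons : ∀ t′ → placed (suc t ∷ᶠ τ) c t′ ≡ ⟦ t ≟ t′ ⟧ * c zero + placed τ (tail c) t′
    placed-cons t′ = cong (λ y → y * c zero + placed τ (tail c) t′) (⟦suc≟suc⟧ t t′)
    placed-other : ∀ t′ → t′ ≢ t → placed (suc t ∷ᶠ τ) c t′ ≡ placed τ (tail c) t′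
    placed-other t′ t′≢t = trans (placed-cons t′) (cong (λ y → y * c zero + _) (⟦⟧-no (t ≟ t′) (t′≢t ∘ sym)))
    placed-here : placed τ (tail c) t ≡ 0 → placed (suc t ∷ᶠ τ) c t ≡ suc x
    placed-here p₀ = begin
      placed (suc t ∷ᶠ τ) c t                   ≡⟨ placed-cons t ⟩
      ⟦ t ≟ t ⟧ * c zero + placed τ (tail c) t  ≡⟨ cong₂ _+_ (cong (_* c zero) (⟦⟧-yes (t ≟ t) refl)) p₀ ⟩
      1 * c zero + 0                            ≡⟨ +-identityʳ (1 * c zero) ⟩
      1 * c zero                                ≡⟨ *-identityˡ (c zero) ⟩
      c zero                                    ≡⟨ c₀≡x+1 ⟩
      suc x                                     ∎
      where open ≡-Reasoning
    unused⇒placed-zero : (∀ j → τ j ≢ suc t) → placed τ (tail c) t ≡ 0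
    unused⇒placed-zero unused = trans (sum-cong-≗ λ j → cong (_* tail c j) (⟦⟧-no (τ j ≟ suc t) (unused j)))
                                      (sum-replicate-zero n)
    forward : Places c α (suc t ∷ᶠ τ) → α t ≡ suc x × Places (tail c) α′ τ
    forward (pl@(_ , inj) , eq) = trans (sym (eq t)) (placed-here p₀) , Placement-tail pl , eq′
      where
      unused : ∀ j → τ j ≢ suc t
      unused j τj≡t+1 with inj zero (suc j) (sym τj≡t+1)
      ... | inj₁ ()
      ... | inj₂ ()
      p₀ = unused⇒placed-zero unused
      eq′ : ∀ t′ → placed τ (tail c) t′ ≡ α′ t′
      eq′ t′ with t′ ≟ t
      ... | yes refl = trans p₀ (sym (updateAt-updates t α))
      ... | no t′≢t  = trans (sym (placed-other t′ t′≢t)) (trans (eq t′) (sym (updateAt-minimal t′ t α t′≢t)))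
    backward : α t ≡ suc x × Places (tail c) α′ τ → Places c α (suc t ∷ᶠ τ)
    backward (αt≡x+1 , pl@(zeros , _) , eq′) =
      Placement-cons (mk⇔ (λ ()) (λ c₀≡0 → case trans (sym c₀≡x+1) c₀≡0 of λ ())) (λ j e → contradiction e (unused j)) pl , eq
      where
      p₀ : placed τ (tail c) t ≡ 0
      p₀ = trans (eq′ t) (updateAt-updates t α)
      unused : ∀ j → τ j ≢ suc t
      unused j τj≡t+1 = case trans (sym τj≡t+1) (from (zeros j) (n≤0⇒n≡0 (subst (tail c j ≤_) p₀ c′j≤p))) of λ ()
        where
        c′j≤p : tail c j ≤ placed τ (tail c) t
        c′j≤p = subst (_≤ placed τ (tail c) t)
                      (trans (cong (_* tail c j) (⟦⟧-yes (τ j ≟ suc t) τj≡t+1)) (*-identityˡ (tail c j)))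
                      (∑-term≤ (λ i → ⟦ τ i ≟ suc t ⟧ * tail c i) j)
      eq : ∀ t′ → placed (suc t ∷ᶠ τ) c t′ ≡ α t′
      eq t′ with t′ ≟ t
      ... | yes refl = trans (placed-here p₀) (sym αt≡x+1)
      ... | no t′≢t  = trans (placed-other t′ t′≢t) (trans (eq′ t′) (updateAt-minimal t′ t α t′≢t))

#parts-updateAt : (α : Fin m → ℕ) (t : Fin m) (i : ℕ) →
                  #parts (suc i) α ≡ ⟦ T? (α t ≡ᵇ suc i) ⟧ + #parts (suc i) (updateAt α t (λ _ → 0))
#parts-updateAt α zero    i = refl
#parts-updateAt α (suc t) i = trans (cong (⟦ T? (α zero ≡ᵇ suc i) ⟧ +_) (#parts-updateAt (tail α) t i))
                                    (+-left-comm ⟦ T? (α zero ≡ᵇ suc i) ⟧ ⟦ T? (α (suc t) ≡ᵇ suc i) ⟧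
                                                 (#parts (suc i) (updateAt (tail α) t (λ _ → 0))))

SameParts-emptyHead : (α : Fin m → ℕ) (c : Fin (suc n) → ℕ) → c zero ≡ 0 → SameParts α c ⇔ SameParts α (tail c)
SameParts-emptyHead α c c₀≡0 = mk⇔ (λ same i → trans (same i) (#parts-tail i)) (λ same i → trans (same i) (sym (#parts-tail i)))
  where
  #parts-tail : ∀ i → #parts (suc i) c ≡ #parts (suc i) (tail c)
  #parts-tail i = cong (_+ #parts (suc i) (tail c))
    (⟦⟧-no (T? (c zero ≡ᵇ suc i)) λ c₀=i+1 → case trans (sym c₀≡0) (≡ᵇ⇒≡ _ _ c₀=i+1) of λ ())

SameParts-updateAt : (α : Fin m → ℕ) (c : Fin (suc n) → ℕ) (t : Fin m) → α t ≡ c zero →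
                     SameParts (updateAt α t (λ _ → 0)) (tail c) ⇔ SameParts α c
SameParts-updateAt α c t αt≡c₀ = mk⇔
  (λ same i → trans (#parts-updateAt α t i) (cong₂ _+_ (shared i) (same i)))
  (λ same i → +-cancelˡ-≡ ⟦ T? (c zero ≡ᵇ suc i) ⟧ _ _
                (trans (cong (_+ _) (sym (shared i))) (trans (sym (#parts-updateAt α t i)) (same i))))
  where
  shared : ∀ i → ⟦ T? (α t ≡ᵇ suc i) ⟧ ≡ ⟦ T? (c zero ≡ᵇ suc i) ⟧
  shared i = cong (λ y → ⟦ T? (y ≡ᵇ suc i) ⟧) αt≡c₀

noParts⇔allZero : (α : Fin m → ℕ) → (∀ i → #parts (suc i) α ≡ 0) ⇔ (∀ t → 0 ≡ α t)
noParts⇔allZero {m} α = mk⇔ allZero noParts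
  where
  allZero : (∀ i → #parts (suc i) α ≡ 0) → ∀ t → 0 ≡ α t
  allZero none t with α t in αt
  ... | zero  = refl
  ... | suc v = contradiction (subst (1 ≤_) (none v)
                  (subst (_≤ #parts (suc v) α) (⟦⟧-yes (T? (α t ≡ᵇ suc v)) hit) (∑-term≤ _ t))) λ ()
    where hit = ≡⇒≡ᵇ (α t) (suc v) αt
  noParts : (∀ t → 0 ≡ α t) → ∀ i → #parts (suc i) α ≡ 0
  noParts zeros i = trans
    (sum-cong-≗ λ t → ⟦⟧-no (T? (α t ≡ᵇ suc i)) λ αt=i+1 → case trans (zeros t) (≡ᵇ⇒≡ _ _ αt=i+1) of λ ())
                          (sum-replicate-zero m)

#placements-suc : (c : Fin (suc n) → ℕ) (α : Fin m → ℕ) →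
                  #placements c α ≡ ∑[ τ ← funs n (allFin (suc m)) ] ⟦ places? c α (zero ∷ᶠ τ) ⟧
                                    + ∑[ t < m ] ∑[ τ ← funs n (allFin (suc m)) ] ⟦ places? c α (suc t ∷ᶠ τ) ⟧
#placements-suc {n} {m} c α = trans (∑-funs-suc {k = n} (allFin (suc m)) (λ τ → ⟦ places? c α τ ⟧))
                                    (∑←-tabulate (λ o → o) λ o → ∑[ τ ← funs n (allFin (suc m)) ] ⟦ places? c α (o ∷ᶠ τ) ⟧)

module _ (c : Fin (suc n) → ℕ) (α : Fin m → ℕ) where

  private
    Ts = funs n (allFin (suc m))

  #placements-emptyHead : c zero ≡ 0 → #placements c α ≡ #placements (tail c) α
  #placements-emptyHead c₀≡0 = begin
    #placements c α
      ≡⟨ #placements-suc c α ⟩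
    ∑[ τ ← Ts ] ⟦ places? c α (zero ∷ᶠ τ) ⟧ + ∑[ t < m ] ∑[ τ ← Ts ] ⟦ places? c α (suc t ∷ᶠ τ) ⟧
      ≡⟨ cong₂ _+_ (∑←-cong Ts λ τ → ⟦⟧-cong (Places-emptyHead c α τ c₀≡0))
                   (trans (sum-cong-≗ λ t → trans (∑←-cong Ts λ τ → ⟦⟧-no (places? c α (suc t ∷ᶠ τ)) (¬Places-emptyHead c α τ c₀≡0 t))
                                                  (∑←-zero Ts))
                          (sum-replicate-zero m)) ⟩
    #placements (tail c) α + 0
      ≡⟨ +-identityʳ _ ⟩
    #placements (tail c) α ∎
    where open ≡-Reasoning

  #placements-partHead : (x : ℕ) → c zero ≡ suc x →
                         #placements c α ≡ ∑[ t < m ] (⟦ T? (α t ≡ᵇ suc x) ⟧ * #placements (tail c) (updateAt α t (λ _ → 0)))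
  #placements-partHead x c₀≡x+1 = begin
    #placements c α
      ≡⟨ #placements-suc c α ⟩
    ∑[ τ ← Ts ] ⟦ places? c α (zero ∷ᶠ τ) ⟧ + ∑[ t < m ] ∑[ τ ← Ts ] ⟦ places? c α (suc t ∷ᶠ τ) ⟧
      ≡⟨ cong (_+ ∑[ t < m ] ∑[ τ ← Ts ] ⟦ places? c α (suc t ∷ᶠ τ) ⟧)
              (trans (∑←-cong Ts λ τ → ⟦⟧-no (places? c α (zero ∷ᶠ τ)) (¬Places-partHead c α τ x c₀≡x+1)) (∑←-zero Ts)) ⟩
    ∑[ t < m ] ∑[ τ ← Ts ] ⟦ places? c α (suc t ∷ᶠ τ) ⟧
      ≡⟨ sum-cong-≗ (λ t → ∑←-cong Ts λ τ →
           trans (⟦⟧-cong {Q? = T? (α t ≡ᵇ suc x) ×-dec places? (tail c) (updateAt α t (λ _ → 0)) τ}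
                          (mk⇔ (λ (e , p) → ≡⇒≡ᵇ _ _ e , p) (λ (e , p) → ≡ᵇ⇒≡ _ _ e , p) ⇔-∘ Places-partHead c α τ x c₀≡x+1 t))
                 (⟦⟧-× (T? (α t ≡ᵇ suc x)) _)) ⟩
    ∑[ t < m ] ∑[ τ ← Ts ] (⟦ T? (α t ≡ᵇ suc x) ⟧ * ⟦ places? (tail c) (updateAt α t (λ _ → 0)) τ ⟧)
      ≡⟨ sum-cong-≗ (λ t → sym (*-distribˡ-∑← ⟦ T? (α t ≡ᵇ suc x) ⟧ Ts λ τ → ⟦ places? (tail c) (updateAt α t (λ _ → 0)) τ ⟧)) ⟩
    ∑[ t < m ] (⟦ T? (α t ≡ᵇ suc x) ⟧ * #placements (tail c) (updateAt α t (λ _ → 0))) ∎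
    where open ≡-Reasoning

#placements-formula : (B : ℕ) (c : Fin n → ℕ) (α : Fin m → ℕ) → (∀ j → c j ≤ B) →
                      #placements c α ≡ partsFactorial B c * ⟦ sameParts? α c ⟧
#placements-formula {zero} B c α _ =
  trans (+-identityʳ _) (trans (⟦⟧-cong {Q? = sameParts? α c} (mk⇔ (λ (_ , eq) → from (noParts⇔allZero α) eq)
                                             (λ same → ((λ ()) , λ ()) , to (noParts⇔allZero α) same)))
                               (sym (trans (cong (_* ⟦ sameParts? α c ⟧) (∏!-zero B)) (*-identityˡ ⟦ sameParts? α c ⟧))))
#placements-formula {suc n} {m} B c α c≤B = byHead (c zero) refl
  where
  open ≡-Reasoning
  α′ : Fin m → Fin m → ℕ
  α′ t = updateAt α t (λ _ → 0)
  Φ′ = partsFactorial B (tail c)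
  IH : ∀ β → #placements (tail c) β ≡ Φ′ * ⟦ sameParts? β (tail c) ⟧
  IH β = #placements-formula B (tail c) β (c≤B ∘ suc)
  byHead : ∀ y → c zero ≡ y → #placements c α ≡ partsFactorial B c * ⟦ sameParts? α c ⟧
  byHead zero c₀≡0 = begin
    #placements c α                           ≡⟨ #placements-emptyHead c α c₀≡0 ⟩
    #placements (tail c) α                    ≡⟨ IH α ⟩
    Φ′ * ⟦ sameParts? α (tail c) ⟧            ≡⟨ cong₂ _*_ Φ-tail (⟦⟧-cong (SameParts-emptyHead α c c₀≡0)) ⟨
    partsFactorial B c * ⟦ sameParts? α c ⟧   ∎
    where
    Φ-tail : partsFactorial B c ≡ Φ′
    Φ-tail = ∏!-cong B {λ i → #parts i c} {λ i → #parts i (tail c)} λ i → cong (_+ #parts (suc i) (tail c))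
               (⟦⟧-no (T? (c zero ≡ᵇ suc i)) λ c₀=i+1 → case trans (sym c₀≡0) (≡ᵇ⇒≡ _ _ c₀=i+1) of λ ())
  byHead (suc x) c₀≡x+1 = begin
    #placements c α
      ≡⟨ #placements-partHead c α x c₀≡x+1 ⟩
    ∑[ t < m ] (⟦ T? (α t ≡ᵇ suc x) ⟧ * #placements (tail c) (α′ t))
      ≡⟨ sum-cong-≗ (λ t → ⟦⟧*-cong (T? (α t ≡ᵇ suc x)) λ αt=x+1 → trans (IH (α′ t))
           (cong (Φ′ *_) (⟦⟧-cong (SameParts-updateAt α c t (trans (≡ᵇ⇒≡ _ _ αt=x+1) (sym c₀≡x+1)))))) ⟩
    ∑[ t < m ] (⟦ T? (α t ≡ᵇ suc x) ⟧ * (Φ′ * ⟦ sameParts? α c ⟧))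
      ≡⟨ *-distribʳ-sum (Φ′ * ⟦ sameParts? α c ⟧) (λ t → ⟦ T? (α t ≡ᵇ suc x) ⟧) ⟨
    #parts (suc x) α * (Φ′ * ⟦ sameParts? α c ⟧)
      ≡⟨ bySameParts (sameParts? α c) ⟩
    partsFactorial B c * ⟦ sameParts? α c ⟧ ∎
    where
    bySameParts : (D : Dec (SameParts α c)) → #parts (suc x) α * (Φ′ * ⟦ D ⟧) ≡ partsFactorial B c * ⟦ D ⟧
    bySameParts (no _)     = trans (cong (#parts (suc x) α *_) (*-zeroʳ Φ′))
                                   (trans (*-zeroʳ (#parts (suc x) α)) (sym (*-zeroʳ (partsFactorial B c))))
    bySameParts (yes same) = begin
      #parts (suc x) α * (Φ′ * 1)                      ≡⟨ *-assoc (#parts (suc x) α) Φ′ 1 ⟨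
      #parts (suc x) α * Φ′ * 1                        ≡⟨ cong (λ y → y * Φ′ * 1) (trans (same x) #parts-head) ⟩
      suc (#parts (suc x) (tail c)) * Φ′ * 1           ≡⟨ cong (_* 1) (∏!-bump B x (λ i → #parts i (tail c)) x<B) ⟨
      ∏! B (λ i → ⟦ T? (suc x ≡ᵇ i) ⟧ + #parts i (tail c)) * 1
        ≡⟨ cong (λ y → ∏! B (λ i → ⟦ T? (y ≡ᵇ i) ⟧ + #parts i (tail c)) * 1) c₀≡x+1 ⟨
      partsFactorial B c * 1                           ∎
      where
      x<B : x < B
      x<B = subst (_≤ B) c₀≡x+1 (c≤B zero)
      #parts-head : #parts (suc x) c ≡ suc (#parts (suc x) (tail c))
      #parts-head = cong (_+ #parts (suc x) (tail c)) (⟦⟧-yes (T? (c zero ≡ᵇ suc x)) (≡⇒≡ᵇ _ _ c₀≡x+1))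

-- Colorings with a prescribed kernel and the monomial coefficients

sizes : (Fin k → Fin m) → Fin m → ℕ
sizes {k} κ t = ∑[ v < k ] ⟦ κ v ≟ t ⟧

HasSizes : (Fin m → ℕ) → (Fin k → Fin m) → Set
HasSizes α κ = ∀ t → sizes κ t ≡ α t

hasSizes? : (α : Fin m → ℕ) (κ : Fin k → Fin m) → Dec (HasSizes α κ)
hasSizes? α κ = all? λ t → sizes κ t ≟ℕ α t

sizes≡0⇔ : (f : Fin k → Fin n) (j : Fin n) → (sizes f j ≡ 0) ⇔ (¬ Image f j)
sizes≡0⇔ f j = mk⇔ (λ s≡0 img → <⇒≢ (from (∑⟦⟧-positive λ v → f v ≟ j) img) (sym s≡0))
                   (λ ¬img → n≤0⇒n≡0 (≮⇒≥ λ pos → ¬img (to (∑⟦⟧-positive λ v → f v ≟ j) pos)))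

fiberColor : (Fin k → Fin n) → (Fin k → Fin m) → Fin n → Fin (suc m)
fiberColor f κ j with image? f j
... | yes (v , _) = suc (κ v)
... | no _        = zero

fiberColor-image : {f : Fin k → Fin n} {κ : Fin k → Fin m} → SameKernel f κ →
                   ∀ v → fiberColor f κ (f v) ≡ suc (κ v)
fiberColor-image {f = f} f~κ v with image? f (f v)
... | yes (v′ , fv′≡fv) = cong suc (to (f~κ v′ v) fv′≡fv)
... | no ¬img           = contradiction (v , refl) ¬img

fiberColor-empty : {f : Fin k → Fin n} {κ : Fin k → Fin m} {j : Fin n} → ¬ Image f j → fiberColor f κ j ≡ zero
fiberColor-empty {f = f} {j = j} ¬img with image? f j
... | yes img = contradiction img ¬img
... | no _    = refl

Colors : (Fin k → Fin n) → (Fin n → Fin (suc m)) → (Fin k → Fin m) → Set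
Colors f τ κ = ∀ v → τ (f v) ≡ suc (κ v)

colors? : (f : Fin k → Fin n) (τ : Fin n → Fin (suc m)) (κ : Fin k → Fin m) → Dec (Colors f τ κ)
colors? f τ κ = all? λ v → τ (f v) ≟ suc (κ v)

module _ (f : Fin k → Fin n) where

  Placement×Colors⇔fiberColor : {τ : Fin n → Fin (suc m)} {κ : Fin k → Fin m} →
    (Placement (sizes f) τ × Colors f τ κ) ⇔ (SameKernel f κ × ∀ j → fiberColor f κ j ≡ τ j)
  Placement×Colors⇔fiberColor {τ = τ} {κ} = mk⇔ forward backward
    where
    forward : Placement (sizes f) τ × Colors f τ κ → SameKernel f κ × ∀ j → fiberColor f κ j ≡ τ j
    forward ((zeros , inj) , col) = f~κ , λ j → fiber j (image? f j)
      where
      f~κ : SameKernel f κ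
      f~κ u v = mk⇔ (λ fu≡fv → suc-injective (trans (sym (col u)) (trans (cong τ fu≡fv) (col v))))
                    (λ κu≡κv → case inj (f u) (f v) (trans (col u) (trans (cong suc κu≡κv) (sym (col v)))) of λ
                      { (inj₁ τfu≡0)  → case trans (sym (col u)) τfu≡0 of λ ()
                      ; (inj₂ fu≡fv) → fu≡fv })
      fiber : ∀ j → Dec (Image f j) → fiberColor f κ j ≡ τ j
      fiber j (yes (v , refl)) = trans (fiberColor-image f~κ v) (sym (col v))
      fiber j (no ¬img)        = trans (fiberColor-empty ¬img) (sym (from (zeros j) (from (sizes≡0⇔ f j) ¬img)))
    backward : SameKernel f κ × (∀ j → fiberColor f κ j ≡ τ j) → Placement (sizes f) τ × Colors f τ κ
    backward (f~κ , τ≗c) = (zeros , inj) , col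
      where
      col : Colors f τ κ
      col v = trans (sym (τ≗c (f v))) (fiberColor-image f~κ v)
      zeros : ∀ j → (τ j ≡ zero) ⇔ (sizes f j ≡ 0)
      zeros j with image? f j
      ... | yes (v , refl) = mk⇔ (λ τfv≡0 → case trans (sym (col v)) τfv≡0 of λ ())
                                 (λ s≡0 → contradiction (v , refl) (to (sizes≡0⇔ f (f v)) s≡0))
      ... | no ¬img        = mk⇔ (λ _ → from (sizes≡0⇔ f j) ¬img) (λ _ → trans (sym (τ≗c j)) (fiberColor-empty ¬img))
      inj : ∀ i j → τ i ≡ τ j → τ i ≡ zero ⊎ i ≡ j
      inj i j τi≡τj with image? f i | image? f j
      ... | no ¬img        | _                = inj₁ (trans (sym (τ≗c i)) (fiberColor-empty ¬img))
      ... | yes (u , refl) | yes (v , refl)   =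
        inj₂ (from (f~κ u v) (suc-injective (trans (sym (col u)) (trans τi≡τj (col v)))))
      ... | yes (u , refl) | no ¬img          =
        case trans (sym (col u)) (trans τi≡τj (trans (sym (τ≗c j)) (fiberColor-empty ¬img))) of λ ()

  ∑-colorings-unique : {τ : Fin n → Fin (suc m)} → Placement (sizes f) τ →
                       ∑[ κ ← funs k (allFin m) ] ⟦ colors? f τ κ ⟧ ≡ 1
  ∑-colorings-unique {m = m} {τ = τ} (zeros , _) =
    ∑-funs-unique (allFin m) (λ v t → τ (f v) ≟ suc t) λ v → unique v (τ (f v)) refl
    where
    unique : ∀ v o → τ (f v) ≡ o → ∑[ t ← allFin m ] ⟦ o ≟ suc t ⟧ ≡ 1
    unique v zero    τfv≡0 = contradiction (v , refl) (to (sizes≡0⇔ f (f v)) (to (zeros (f v)) τfv≡0))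
    unique v (suc s) _     = trans (∑←-tabulate (λ t → t) λ t → ⟦ suc s ≟ suc t ⟧)
                                   (trans (sum-cong-≗ λ t → trans (⟦suc≟suc⟧ s t) (sym (*-identityʳ _))) (∑-δ′ s λ _ → 1))

  placed-sizes : {τ : Fin n → Fin (suc m)} {κ : Fin k → Fin m} → Colors f τ κ → ∀ t → placed τ (sizes f) t ≡ sizes κ t
  placed-sizes {τ = τ} {κ} col t = begin
    ∑[ j < n ] (⟦ τ j ≟ suc t ⟧ * ∑[ v < k ] ⟦ f v ≟ j ⟧)
      ≡⟨ sum-cong-≗ (λ j → *-distribˡ-sum ⟦ τ j ≟ suc t ⟧ (λ v → ⟦ f v ≟ j ⟧)) ⟩
    ∑[ j < n ] ∑[ v < k ] (⟦ τ j ≟ suc t ⟧ * ⟦ f v ≟ j ⟧)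
      ≡⟨ ∑-comm (λ j v → ⟦ τ j ≟ suc t ⟧ * ⟦ f v ≟ j ⟧) ⟩
    ∑[ v < k ] ∑[ j < n ] (⟦ τ j ≟ suc t ⟧ * ⟦ f v ≟ j ⟧)
      ≡⟨ sum-cong-≗ (λ v → trans (sum-cong-≗ λ j → *-comm ⟦ τ j ≟ suc t ⟧ _) (∑-δ′ (f v) λ j → ⟦ τ j ≟ suc t ⟧)) ⟩
    ∑[ v < k ] ⟦ τ (f v) ≟ suc t ⟧
      ≡⟨ sum-cong-≗ (λ v → trans (cong (λ o → ⟦ o ≟ suc t ⟧) (col v)) (⟦suc≟suc⟧ (κ v) t)) ⟩
    sizes κ t ∎
    where open ≡-Reasoning

  #placements-sizes : (α : Fin m → ℕ) →
                      #placements (sizes f) α ≡ ∑[ κ ← funs k (allFin m) ] (⟦ hasSizes? α κ ⟧ * ⟦ sameKernel? f κ ⟧)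
  #placements-sizes {m = m} α = begin
    ∑[ τ ← Ts ] places τ
      ≡⟨ ∑←-cong Ts (λ τ → trans (sym (*-identityʳ (places τ))) (⟦⟧*-cong (places? (sizes f) α τ) λ (pl , _) →
           sym (∑-colorings-unique {τ = τ} pl))) ⟩
    ∑[ τ ← Ts ] (places τ * ∑[ κ ← Ks ] colors τ κ)
      ≡⟨ ∑←-cong Ts (λ τ → *-distribˡ-∑← (places τ) Ks (colors τ)) ⟩
    ∑[ τ ← Ts ] ∑[ κ ← Ks ] (places τ * colors τ κ)
      ≡⟨ ∑←-comm Ts Ks (λ τ κ → places τ * colors τ κ) ⟩
    ∑[ κ ← Ks ] ∑[ τ ← Ts ] (places τ * colors τ κ)
      ≡⟨ ∑←-cong Ks (λ κ → ∑←-cong Ts λ τ → ⟦⟧*⟦⟧-cong {P? = places? (sizes f) α τ} {Q? = colors? f τ κ}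
           {R? = hasSizes? α κ} {S? = sameKernel? f κ ×-dec fiberColors? κ τ} regroup) ⟩
    ∑[ κ ← Ks ] ∑[ τ ← Ts ] (sized κ * ⟦ sameKernel? f κ ×-dec fiberColors? κ τ ⟧)
      ≡⟨ ∑←-cong Ks (λ κ → ∑←-cong Ts λ τ → cong (sized κ *_) (⟦⟧-× (sameKernel? f κ) (fiberColors? κ τ))) ⟩
    ∑[ κ ← Ks ] ∑[ τ ← Ts ] (sized κ * (sameKer κ * ⟦ fiberColors? κ τ ⟧))
      ≡⟨ ∑←-cong Ks (λ κ → trans (sym (*-distribˡ-∑← (sized κ) Ts _)) (cong (sized κ *_)
           (trans (sym (*-distribˡ-∑← (sameKer κ) Ts λ τ → ⟦ fiberColors? κ τ ⟧)) (cong (sameKer κ *_) (∑-funs-≗ (fiberColor f κ)))))) ⟩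
    ∑[ κ ← Ks ] (sized κ * (sameKer κ * 1))
      ≡⟨ ∑←-cong Ks (λ κ → cong (sized κ *_) (*-identityʳ (sameKer κ))) ⟩
    ∑[ κ ← Ks ] (sized κ * sameKer κ) ∎
    where
    open ≡-Reasoning
    Ts = funs n (allFin (suc m))
    Ks = funs k (allFin m)
    places : (Fin n → Fin (suc m)) → ℕ
    places τ = ⟦ places? (sizes f) α τ ⟧
    colors : (Fin n → Fin (suc m)) → (Fin k → Fin m) → ℕ
    colors τ κ = ⟦ colors? f τ κ ⟧
    sized sameKer : (Fin k → Fin m) → ℕ
    sized κ = ⟦ hasSizes? α κ ⟧
    sameKer κ = ⟦ sameKernel? f κ ⟧
    fiberColors? : (κ : Fin k → Fin m) (τ : Fin n → Fin (suc m)) → Dec (∀ j → fiberColor f κ j ≡ τ j)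
    fiberColors? κ τ = all? λ j → fiberColor f κ j ≟ τ j
    regroup : ∀ {τ κ} → (Places (sizes f) α τ × Colors f τ κ) ⇔
                        (HasSizes α κ × SameKernel f κ × ∀ j → fiberColor f κ j ≡ τ j)
    regroup {τ} {κ} = mk⇔
      (λ ((pl , eq) , col) → (λ t → trans (sym (placed-sizes {τ = τ} col t)) (eq t)) , to Placement×Colors⇔fiberColor (pl , col))
      (λ (hs , r) → let (pl , col) = from Placement×Colors⇔fiberColor r in
                    (pl , λ t → trans (placed-sizes {τ = τ} col t) (hs t)) , col)

typeOf-sizes : (f : Fin k → Fin n) → typeOf f ≡ partitionOf (tabulate (sizes f))
typeOf-sizes {k} f = cong partitionOf (tabulate-cong λ j →
  trans (countFin-∑ (λ v → f v == j)) (sum-cong-≗ λ v → ⟦⟧-cong {P? = T? (f v == j)} {Q? = f v ≟ j} ==⇔≡))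

length-partitionOf-sizes : (f : Fin k → Fin n) → length (partitionOf (tabulate (sizes f))) ≡ #classes f
length-partitionOf-sizes {n = n} f = begin
  length (partitionOf (tabulate (sizes f)))            ≡⟨ length-partitionOf (tabulate (sizes f)) ⟩
  length (nonzeros (tabulate (sizes f)))               ≡⟨ length-filterᵇ _ (tabulate (sizes f)) ⟩
  ∑[ x ← tabulate (sizes f) ] ⟦ T? (not (x ≡ᵇ 0)) ⟧    ≡⟨ ∑←-tabulate (sizes f) (λ x → ⟦ T? (not (x ≡ᵇ 0)) ⟧) ⟩
  ∑[ j < n ] ⟦ T? (not (sizes f j ≡ᵇ 0)) ⟧             ≡⟨ sum-cong-≗ (λ j → ⟦⟧-cong {Q? = image? f j}
                                                           (∑⟦⟧-positive (λ v → f v ≟ j) ⇔-∘ T-not-≡ᵇ0 (sizes f j))) ⟩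
  ∑[ j < n ] ⟦ image? f j ⟧                           ≡⟨ ∑-image f ⟩
  #classes f                                          ∎
  where open ≡-Reasoning

monomialCoefficient : (f : Fin k → Fin n) (α : Fin m → ℕ) →
                      scaleFactor n (typeOf f) * coeffMono m α (typeOf f) ≡ (n ∸ #classes f) ! * #placements (sizes f) α
monomialCoefficient {n = n} {m = m} f α rewrite typeOf-sizes f = begin
  ∏! total (λ i → mult i λ′) * (n ∸ length λ′) ! * coeffMono m α λ′
    ≡⟨ cong₂ (λ x y → x * (n ∸ y) ! * coeffMono m α λ′) Φ≡ (length-partitionOf-sizes f) ⟩
  partsFactorial total c * (n ∸ #classes f) ! * coeffMono m α λ′
    ≡⟨ cong (partsFactorial total c * (n ∸ #classes f) ! *_) coeff≡ ⟩
  partsFactorial total c * (n ∸ #classes f) ! * ⟦ sameParts? α c ⟧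
    ≡⟨ cong (_* ⟦ sameParts? α c ⟧) (*-comm (partsFactorial total c) ((n ∸ #classes f) !)) ⟩
  (n ∸ #classes f) ! * partsFactorial total c * ⟦ sameParts? α c ⟧
    ≡⟨ *-assoc ((n ∸ #classes f) !) (partsFactorial total c) _ ⟩
  (n ∸ #classes f) ! * (partsFactorial total c * ⟦ sameParts? α c ⟧)
    ≡⟨ cong ((n ∸ #classes f) ! *_) (#placements-formula total c α c≤total) ⟨
  (n ∸ #classes f) ! * #placements c α ∎
  where
  open ≡-Reasoning
  c = sizes f
  λ′ = partitionOf (tabulate c)
  total = sum λ′
  Φ≡ : ∏! total (λ i → mult i λ′) ≡ partsFactorial total c
  Φ≡ = ∏!-cong total {λ i → mult i λ′} {λ i → #parts i c} λ i → trans (mult-partitionOf i (tabulate c)) (mult-tabulate (suc i) c)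
  coeff≡ : coeffMono m α λ′ ≡ ⟦ sameParts? α c ⟧
  coeff≡ = trans (if-then-1-else-0 _) (⟦⟧-cong (partitionOf-≡⇔SameParts α c ⇔-∘ T-==ℓ _ λ′))
  c≤total : ∀ j → c j ≤ total
  c≤total j = subst (c j ≤_) (sym (trans (sum-partitionOf (tabulate c)) (sum-tabulate c))) (∑-term≤ c j)

-- Weighted colorings

module _ (H : WGraph) where

  open WGraph H

  ProperW : (Fin size → Fin m) → Set
  ProperW κ = ∀ u v → T (adj u v) → κ u ≢ κ v

  properW? : (κ : Fin size → Fin m) → Dec (ProperW κ)
  properW? κ = all? λ u → all? λ v → T? (adj u v) →-dec ¬? (κ u ≟ κ v)

  weight : (Fin size → Fin m) → Fin m → ℕ
  weight κ c = ∑[ v < size ] (⟦ κ v ≟ c ⟧ * wt v)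

  HasWeights : (Fin m → ℕ) → (Fin size → Fin m) → Set
  HasWeights α κ = ∀ c → weight κ c ≡ α c

  hasWeights? : (α : Fin m → ℕ) (κ : Fin size → Fin m) → Dec (HasWeights α κ)
  hasWeights? α κ = all? λ c → weight κ c ≟ℕ α c

  ProperW×HasWeights-resp : {α : Fin m → ℕ} {κ κ′ : Fin size → Fin m} → (∀ i → κ i ≡ κ′ i) →
                            ProperW κ × HasWeights α κ → ProperW κ′ × HasWeights α κ′
  ProperW×HasWeights-resp κ≗κ′ (p , w) =
    (λ u v a e → p u v a (trans (κ≗κ′ u) (trans e (sym (κ≗κ′ v))))) ,
    (λ c → trans (sum-cong-≗ λ v → cong (λ x → ⟦ x ≟ c ⟧ * wt v) (sym (κ≗κ′ v))) (w c))

  coeffX-spec : (α : Fin m → ℕ) → coeffX H m α ≡ ∑[ κ ← funs size (allFin m) ] ⟦ properW? κ ×-dec hasWeights? α κ ⟧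
  coeffX-spec {m} α = trans (length-filterᵇ _ (allFuns size (allFin m)))
    (trans (∑←-cong (allFuns size (allFin m)) λ κ → ⟦⟧-cong {Q? = properW? κ ×-dec hasWeights? α κ} (condition κ))
           (∑-allFuns (allFin m) (λ κ → ⟦ properW? κ ×-dec hasWeights? α κ ⟧) λ κ≗κ′ →
             ⟦⟧-cong (mk⇔ (ProperW×HasWeights-resp κ≗κ′) (ProperW×HasWeights-resp (sym ∘ κ≗κ′)))))
    where
    -- the unfolding of the condition `ok` of `coeffX`, which is local to its definition
    condition : ∀ κ → T (allFinᵇ size (λ u → allFinᵇ size (λ v → not (adj u v ∧ (κ u == κ v))))
                         ∧ allFinᵇ m (λ c → sumFin size (λ v → if κ v == c then wt v else 0) ≡ᵇ α c))
                      ⇔ (ProperW κ × HasWeights α κ)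
    condition κ = mk⇔
      (λ t → let (tp , tw) = to T-∧ t in
             (λ u v a κu≡κv → to (T-not _) (to (T-allFinᵇ _) (to (T-allFinᵇ _) tp u) v) (from T-∧ (a , from ==⇔≡ κu≡κv))) ,
             (λ c → trans (sym (weight≡ c)) (to (T-≡ᵇ _ _) (to (T-allFinᵇ _) tw c))))
      (λ (p , w) → from T-∧ (from (T-allFinᵇ _) (λ u → from (T-allFinᵇ _) λ v → from (T-not _) λ t →
                                 let (a , e) = to T-∧ t in p u v a (to ==⇔≡ e)) ,
                             from (T-allFinᵇ _) (λ c → from (T-≡ᵇ _ _) (trans (weight≡ c) (w c)))))
      where
      weight≡ : ∀ c → sumFin size (λ v → if κ v == c then wt v else 0) ≡ weight κ c
      weight≡ c = trans (sum-tabulate (λ v → if κ v == c then wt v else 0)) (sum-cong-≗ λ v → if==-⟦≟⟧ (κ v) c (wt v))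

-- Homomorphisms into the looped complete graph

T-toℕ≡ᵇ0 : (i : Fin (suc n)) → T (toℕ i ≡ᵇ 0) ⇔ (i ≡ zero)
T-toℕ≡ᵇ0 zero    = mk⇔ (λ _ → refl) (λ _ → tt)
T-toℕ≡ᵇ0 (suc i) = mk⇔ (λ ()) (λ ())

LoopAdjacent : Fin (suc n) → Fin (suc n) → Set
LoopAdjacent i j = (i ≡ zero × j ≡ zero) ⊎ i ≢ j

T-adjKLoop : (i j : Fin (suc n)) → T (adjKLoop (suc n) i j) ⇔ LoopAdjacent i j
T-adjKLoop i j = (((T-toℕ≡ᵇ0 i ×-⇔ T-toℕ≡ᵇ0 j) ⇔-∘ T-∧) ⊎-⇔ (¬-cong-⇔ ==⇔≡ ⇔-∘ T-not (i == j))) ⇔-∘ T-∨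

module _ (G : Graph k) where

  Adjacent : Fin k → Fin k → Set
  Adjacent u v = T (Graph.adj G u v)

  Adjacent-sym : ∀ {u v} → Adjacent u v → Adjacent v u
  Adjacent-sym {u} {v} = subst T (Graph.sym G u v)

  Adjacent-irrefl : ∀ {v} → ¬ Adjacent v v
  Adjacent-irrefl {v} a = subst T (Graph.loopless G v) a

  Clash : (Fin k → Fin m) → Fin k → Set
  Clash κ u = ∃ λ v → Adjacent u v × κ u ≡ κ v

  clash? : (κ : Fin k → Fin m) (u : Fin k) → Dec (Clash κ u)
  clash? κ u = any? λ v → T? (Graph.adj G u v) ×-dec κ u ≟ κ v

  clashes : (Fin k → Fin m) → Fin k → Bool
  clashes κ u = isYes (clash? κ u)

  T-clashes : {κ : Fin k → Fin m} {u : Fin k} → T (clashes κ u) ⇔ Clash κ u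
  T-clashes {κ = κ} {u} = mk⇔ (toWitness {a? = clash? κ u}) (fromWitness {a? = clash? κ u})

  Proper : (Fin k → Fin m) → Set
  Proper = ProperW (unweighted G)

  proper? : (κ : Fin k → Fin m) → Dec (Proper κ)
  proper? = properW? (unweighted G)

  Proper⇔noClash : {κ : Fin k → Fin m} → Proper κ ⇔ (¬ NonEmpty (clashes κ))
  Proper⇔noClash = mk⇔ (λ proper (u , c) → let (v , a , e) = to T-clashes c in proper u v a e)
                       (λ none u v a e → none (u , from T-clashes (v , a , e)))

  AlmostProper : (Fin k → Fin m) → Set
  AlmostProper κ = NonEmpty (clashes κ) × ConstantOn (clashes κ) κ

  almostProper? : (κ : Fin k → Fin m) → Dec (AlmostProper κ)
  almostProper? κ = nonEmpty? (clashes κ) ×-dec constantOn? (clashes κ) κ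

  IsHom : (Fin k → Fin (suc n)) → Set
  IsHom f = ∀ u v → Adjacent u v → LoopAdjacent (f u) (f v)

  T-isHomᵇ : (f : Fin k → Fin (suc n)) → T (isHomᵇ (suc n) G f) ⇔ IsHom f
  T-isHomᵇ f = mk⇔
    (λ t u v a → to (T-adjKLoop (f u) (f v)) (to (T-implies _ _) (to (T-allFinᵇ _) (to (T-allFinᵇ _) t u) v) a))
    (λ h → from (T-allFinᵇ _) λ u → from (T-allFinᵇ _) λ v → from (T-implies _ _) λ a → from (T-adjKLoop (f u) (f v)) (h u v a))

  IsHom⇔zeroOnClashes : {κ : Fin k → Fin m} {f : Fin k → Fin (suc n)} → SameKernel κ f →
                        IsHom f ⇔ (∀ u → T (clashes κ u) → f u ≡ zero)
  IsHom⇔zeroOnClashes {κ = κ} {f} κ~f = mk⇔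
    (λ hom u c → let (v , a , κu≡κv) = to T-clashes c in
                 case hom u v a of λ { (inj₁ (fu≡0 , _)) → fu≡0 ; (inj₂ fu≢fv) → contradiction (to (κ~f u v) κu≡κv) fu≢fv })
    (λ zeroOn u v a → case f u ≟ f v of λ
       { (no fu≢fv)  → inj₂ fu≢fv
       ; (yes fu≡fv) → let κu≡κv = from (κ~f u v) fu≡fv in
                       inj₁ (zeroOn u (from T-clashes (v , a , κu≡κv)) , zeroOn v (from T-clashes (u , Adjacent-sym a , sym κu≡κv))) })

module _ (G : Graph k) (κ : Fin k → Fin m) where

  ∑-homs-of-kernel : k ≤ suc n →
    ∑[ f ← funs k (allFin (suc n)) ] (⟦ T? (isHomᵇ (suc n) G f) ⟧ * ((suc n ∸ #classes f) ! * ⟦ sameKernel? f κ ⟧))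
      ≡ suc n ! * ⟦ proper? G κ ⟧ + n ! * ⟦ almostProper? G κ ⟧
  ∑-homs-of-kernel {n = n} k≤N = begin
    ∑[ f ← Fs ] (⟦ T? (isHomᵇ (suc n) G f) ⟧ * ((suc n ∸ #classes f) ! * ⟦ sameKernel? f κ ⟧))
      ≡⟨ ∑←-cong Fs kernelMap-term ⟩
    ∑[ f ← Fs ] ((suc n ∸ #classes κ) ! * ⟦ kernelMap? full κ Z f ⟧)
      ≡⟨ *-distribˡ-∑← ((suc n ∸ #classes κ) !) Fs (λ f → ⟦ kernelMap? full κ Z f ⟧) ⟨
    (suc n ∸ #classes κ) ! * #kernelMaps full κ Z
      ≡⟨ cong ((suc n ∸ #classes κ) ! *_) (#kernelMaps-formula κ full Z) ⟩
    (suc n ∸ #classes κ) ! * kernelMapCount full (#classes κ) (nonEmpty? Z) (constantOn? Z κ)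
      ≡⟨ kernelMapCount-all (#classes κ) (nonEmpty? Z) (constantOn? Z κ) (≤-trans (#classes≤ κ) k≤N)
                            (λ (v , _) → #classes-positive κ v) ⟩
    suc n ! * ⟦ ¬? (nonEmpty? Z) ⟧ + n ! * ⟦ almostProper? G κ ⟧
      ≡⟨ cong (λ x → suc n ! * x + n ! * ⟦ almostProper? G κ ⟧) (⟦⟧-cong (⇔-sym (Proper⇔noClash G))) ⟩
    suc n ! * ⟦ proper? G κ ⟧ + n ! * ⟦ almostProper? G κ ⟧ ∎
    where
    open ≡-Reasoning
    Fs = funs k (allFin (suc n))
    Z = clashes G κ
    hom×kernel⇔ : ∀ {f} → (T (isHomᵇ (suc n) G f) × SameKernel f κ) ⇔ KernelMap full κ Z f
    hom×kernel⇔ {f} = mk⇔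
      (λ (hom , f~κ) → (λ _ → tt) , SameKernel-sym f~κ , to (IsHom⇔zeroOnClashes G (SameKernel-sym f~κ)) (to (T-isHomᵇ G f) hom))
      (λ (_ , κ~f , zeroOn) → from (T-isHomᵇ G f) (from (IsHom⇔zeroOnClashes G κ~f) zeroOn) , SameKernel-sym κ~f)
    kernelMap-term : ∀ f → ⟦ T? (isHomᵇ (suc n) G f) ⟧ * ((suc n ∸ #classes f) ! * ⟦ sameKernel? f κ ⟧)
                           ≡ (suc n ∸ #classes κ) ! * ⟦ kernelMap? full κ Z f ⟧
    kernelMap-term f = begin
      ⟦ T? (isHomᵇ (suc n) G f) ⟧ * ((suc n ∸ #classes f) ! * ⟦ sameKernel? f κ ⟧)
        ≡⟨ *-left-comm ⟦ T? (isHomᵇ (suc n) G f) ⟧ ((suc n ∸ #classes f) !) ⟦ sameKernel? f κ ⟧ ⟩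
      (suc n ∸ #classes f) ! * (⟦ T? (isHomᵇ (suc n) G f) ⟧ * ⟦ sameKernel? f κ ⟧)
        ≡⟨ cong ((suc n ∸ #classes f) ! *_) (trans (sym (⟦⟧-× (T? (isHomᵇ (suc n) G f)) (sameKernel? f κ))) (⟦⟧-cong hom×kernel⇔)) ⟩
      (suc n ∸ #classes f) ! * ⟦ kernelMap? full κ Z f ⟧
        ≡⟨ *⟦⟧-cong (kernelMap? full κ Z f) (λ (_ , κ~f , _) → cong (λ l → (suc n ∸ l) !) (#classes-cong (SameKernel-sym κ~f))) ⟩
      (suc n ∸ #classes κ) ! * ⟦ kernelMap? full κ Z f ⟧ ∎

-- Contractions

ClashesWithin : Graph k → (Fin k → Bool) → (Fin k → Fin m) → Set
ClashesWithin G W κ = ∀ u v → Adjacent G u v → κ u ≡ κ v → T (W u) × T (W v)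

clashesWithin? : (G : Graph k) (W : Fin k → Bool) (κ : Fin k → Fin m) → Dec (ClashesWithin G W κ)
clashesWithin? G W κ = all? λ u → all? λ v → T? (Graph.adj G u v) →-dec (κ u ≟ κ v) →-dec (T? (W u) ×-dec T? (W v))

module _ (G : Graph k) (W : Fin k → Bool) where

  outside : List (Fin k)
  outside = filterᵇ (λ v → not (W v)) (allFin k)

  out : Fin (length outside) → Fin k
  out = lookup outside

  out-∉ : ∀ i → ¬ T (W (out i))
  out-∉ i = to (T-not (W (out i))) (All.lookup (all-filter (T? ∘ λ v → not (W v)) (allFin k)) (∈-lookup i))

  out-injective : ∀ i j → out i ≡ out j → i ≡ j
  out-injective = lookup-injective (Unique.filter⁺ (T? ∘ λ v → not (W v)) (Unique.allFin⁺ k))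

  outside-∈ : ∀ {v} → ¬ T (W v) → v ∈ outside
  outside-∈ {v} ∉W = ∈-filter⁺ (T? ∘ λ v → not (W v)) (∈-allFin v) (from (T-not (W v)) ∉W)

  collapse : Fin k → Fin (suc (length outside))
  collapse v with T? (W v)
  ... | yes _  = zero
  ... | no ∉W = suc (Any.index (outside-∈ ∉W))

  collapse-∈ : ∀ {v} → T (W v) → collapse v ≡ zero
  collapse-∈ {v} ∈W with T? (W v)
  ... | yes _  = refl
  ... | no ∉W = contradiction ∈W ∉W

  collapse-∉ : ∀ {v} → ¬ T (W v) → ∃ λ i → collapse v ≡ suc i × out i ≡ v
  collapse-∉ {v} ∉W with T? (W v)
  ... | yes ∈W = contradiction ∈W ∉W
  ... | no ∉W′ = Any.index (outside-∈ ∉W′) , refl , sym (lookup-index (outside-∈ ∉W′))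

  T-touches : ∀ v → T (not (countFin k (λ u → W u ∧ Graph.adj G u v) ≡ᵇ 0)) ⇔ (∃ λ u → T (W u) × Adjacent G u v)
  T-touches v = mk⇔ (λ t → let (u , t′) = to (countFin-positive _) t in u , to T-∧ t′)
                    (λ (u , w , a) → from (countFin-positive _) (u , from T-∧ (w , a)))

  collapse-adjacent : ∀ {u v} → Adjacent G u v → ¬ (T (W u) × T (W v)) →
                      T (WGraph.adj (contract G W) (collapse u) (collapse v))
  collapse-adjacent {u} {v} a ¬both = byMembership (T? (W u)) (T? (W v))
    where
    Adj/W : Fin (suc (length outside)) → Fin (suc (length outside)) → Set
    Adj/W x y = T (WGraph.adj (contract G W) x y)
    byMembership : Dec (T (W u)) → Dec (T (W v)) → Adj/W (collapse u) (collapse v)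
    byMembership (yes ∈u) (yes ∈v) = contradiction (∈u , ∈v) ¬both
    byMembership (yes ∈u) (no ∉v)  = let (j , cv , oj) = collapse-∉ ∉v in
      subst₂ Adj/W (sym (collapse-∈ ∈u)) (sym cv) (from (T-touches (out j)) (u , ∈u , subst (Adjacent G u) (sym oj) a))
    byMembership (no ∉u)  (yes ∈v) = let (i , cu , oi) = collapse-∉ ∉u in
      subst₂ Adj/W (sym cu) (sym (collapse-∈ ∈v)) (from (T-touches (out i)) (v , ∈v , subst (Adjacent G v) (sym oi) (Adjacent-sym G a)))
    byMembership (no ∉u)  (no ∉v)  = let (i , cu , oi) = collapse-∉ ∉u ; (j , cv , oj) = collapse-∉ ∉v in
      subst₂ Adj/W (sym cu) (sym cv) (subst₂ (Adjacent G) (sym oi) (sym oj) a)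

  module _ {w₀ : Fin k} (w₀∈W : T (W w₀)) where

    expand : Fin (suc (length outside)) → Fin k
    expand zero    = w₀
    expand (suc i) = out i

    collapse∘expand : ∀ i → collapse (expand i) ≡ i
    collapse∘expand zero    = collapse-∈ w₀∈W
    collapse∘expand (suc i) = let (i′ , c , o) = collapse-∉ (out-∉ i) in trans c (cong suc (out-injective i′ i o))

    ConstantOn⇔ : {κ : Fin k → Fin m} → ConstantOn W κ ⇔ (∀ v → κ (expand (collapse v)) ≡ κ v)
    ConstantOn⇔ {κ = κ} = mk⇔
      (λ const v → byMembership const v (T? (W v)))
      (λ h u v ∈u ∈v → trans (sym (h u)) (trans (cong (κ ∘ expand) (trans (collapse-∈ ∈u) (sym (collapse-∈ ∈v)))) (h v)))
      where
      byMembership : ConstantOn W κ → ∀ v → Dec (T (W v)) → κ (expand (collapse v)) ≡ κ v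
      byMembership const v (yes ∈v) = trans (cong (κ ∘ expand) (collapse-∈ ∈v)) (const w₀ v w₀∈W ∈v)
      byMembership const v (no ∉v)  = let (i , c , o) = collapse-∉ ∉v in trans (cong (κ ∘ expand) c) (cong κ o)

    ProperW⇔ClashesWithin : {κ : Fin k → Fin m} → ConstantOn W κ → ProperW (contract G W) (κ ∘ expand) ⇔ ClashesWithin G W κ
    ProperW⇔ClashesWithin {κ = κ} const = mk⇔
      (λ proper u v a κu≡κv → case T? (W u) ×-dec T? (W v) of λ
         { (yes both) → both
         ; (no ¬both) → contradiction (trans (h u) (trans κu≡κv (sym (h v))))
                                      (proper (collapse u) (collapse v) (collapse-adjacent a ¬both)) })
      (λ within → properByCases within)
      where
      h = to ConstantOn⇔ const
      properByCases : ClashesWithin G W κ → ProperW (contract G W) (κ ∘ expand)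
      properByCases within zero    zero    ()
      properByCases within zero    (suc j) a e = let (u , ∈u , a′) = to (T-touches (out j)) a in
        out-∉ j (proj₂ (within u (out j) a′ (trans (const u w₀ ∈u w₀∈W) e)))
      properByCases within (suc i) zero    a e = let (u , ∈u , a′) = to (T-touches (out i)) a in
        out-∉ i (proj₁ (within (out i) u (Adjacent-sym G a′) (trans e (const w₀ u w₀∈W ∈u))))
      properByCases within (suc i) (suc j) a e = out-∉ i (proj₁ (within (out i) (out j) a e))

    weight≡sizes : {κ : Fin k → Fin m} → ConstantOn W κ → ∀ c → weight (contract G W) (κ ∘ expand) c ≡ sizes κ c
    weight≡sizes {κ = κ} const c = begin
      ⟦ κ w₀ ≟ c ⟧ * countFin k W + ∑[ i < length outside ] (⟦ κ (out i) ≟ c ⟧ * 1)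
        ≡⟨ cong₂ _+_ (*-comm ⟦ κ w₀ ≟ c ⟧ (countFin k W)) (sum-cong-≗ λ i → *-identityʳ ⟦ κ (out i) ≟ c ⟧) ⟩
      countFin k W * ⟦ κ w₀ ≟ c ⟧ + ∑[ i < length outside ] ⟦ κ (out i) ≟ c ⟧
        ≡⟨ cong₂ _+_ insideW (sym (∑←-lookup outside λ v → ⟦ κ v ≟ c ⟧)) ⟩
      ∑[ v < k ] (⟦ T? (W v) ⟧ * ⟦ κ v ≟ c ⟧) + ∑[ v ← outside ] ⟦ κ v ≟ c ⟧
        ≡⟨ cong (∑[ v < k ] (⟦ T? (W v) ⟧ * ⟦ κ v ≟ c ⟧) +_)
                (trans (∑←-filterᵇ (λ v → not (W v)) (allFin k) λ v → ⟦ κ v ≟ c ⟧)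
                       (∑←-tabulate (λ v → v) λ v → ⟦ T? (not (W v)) ⟧ * ⟦ κ v ≟ c ⟧)) ⟩
      ∑[ v < k ] (⟦ T? (W v) ⟧ * ⟦ κ v ≟ c ⟧) + ∑[ v < k ] (⟦ T? (not (W v)) ⟧ * ⟦ κ v ≟ c ⟧)
        ≡⟨ ∑-distrib-+ (λ v → ⟦ T? (W v) ⟧ * ⟦ κ v ≟ c ⟧) (λ v → ⟦ T? (not (W v)) ⟧ * ⟦ κ v ≟ c ⟧) ⟨
      ∑[ v < k ] (⟦ T? (W v) ⟧ * ⟦ κ v ≟ c ⟧ + ⟦ T? (not (W v)) ⟧ * ⟦ κ v ≟ c ⟧)
        ≡⟨ sum-cong-≗ (λ v → split (W v) ⟦ κ v ≟ c ⟧) ⟩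
      sizes κ c ∎
      where
      open ≡-Reasoning
      split : ∀ b x → ⟦ T? b ⟧ * x + ⟦ T? (not b) ⟧ * x ≡ x
      split true  x = trans (+-identityʳ (x + 0)) (+-identityʳ x)
      split false x = +-identityʳ x
      insideW : countFin k W * ⟦ κ w₀ ≟ c ⟧ ≡ ∑[ v < k ] (⟦ T? (W v) ⟧ * ⟦ κ v ≟ c ⟧)
      insideW = trans (cong (_* ⟦ κ w₀ ≟ c ⟧) (countFin-∑ W))
               (trans (*-distribʳ-sum ⟦ κ w₀ ≟ c ⟧ (λ v → ⟦ T? (W v) ⟧))
                      (sum-cong-≗ λ v → ⟦⟧*-cong (T? (W v)) λ ∈v → cong (λ x → ⟦ x ≟ c ⟧) (const w₀ v w₀∈W ∈v)))

    coeffX-contract : (α : Fin m → ℕ) →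
      coeffX (contract G W) m α ≡ ∑[ κ ← funs k (allFin m) ] ⟦ (constantOn? W κ ×-dec clashesWithin? G W κ) ×-dec hasSizes? α κ ⟧
    coeffX-contract α = trans (coeffX-spec (contract G W) α) (sym (∑-funs-reindex
      (λ κ → (constantOn? W κ ×-dec clashesWithin? G W κ) ×-dec hasSizes? α κ)
      (λ κ′ → properW? (contract G W) κ′ ×-dec hasWeights? (contract G W) α κ′)
      expand collapse collapse∘expand (ProperW×HasWeights-resp (contract G W)) regroup))
      where
      regroup : ∀ κ → ((ConstantOn W κ × ClashesWithin G W κ) × HasSizes α κ) ⇔
                      ((ProperW (contract G W) (κ ∘ expand) × HasWeights (contract G W) α (κ ∘ expand)) ×
                       ∀ v → κ (expand (collapse v)) ≡ κ v)
      regroup κ = mk⇔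
        (λ ((const , within) , hs) → (from (ProperW⇔ClashesWithin const) within , λ c → trans (weight≡sizes const c) (hs c)) ,
                                      to ConstantOn⇔ const)
        (λ ((proper , hw) , h) → let const = from ConstantOn⇔ h in
                                 (const , to (ProperW⇔ClashesWithin const) proper) , λ c → trans (sym (weight≡sizes const c)) (hw c))

∑-subsets-unique : (Z : Fin k → Bool) → ∑[ W ← allSubsets k ] ⟦ all? (λ v → Z v ≟ᵇ W v) ⟧ ≡ 1
∑-subsets-unique {k} Z = trans
  (∑-allFuns (true ∷ false ∷ []) (λ W → ⟦ all? (λ v → Z v ≟ᵇ W v) ⟧)
             λ W≗W′ → ⟦⟧-cong (mk⇔ (λ e v → trans (e v) (W≗W′ v)) (λ e v → trans (e v) (sym (W≗W′ v)))))
  (∑-funs-unique (true ∷ false ∷ []) (λ v b → Z v ≟ᵇ b) λ v → one (Z v))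
  where
  one : ∀ x → ∑[ b ← true ∷ false ∷ [] ] ⟦ x ≟ᵇ b ⟧ ≡ 1
  one true  = refl
  one false = refl

module _ (G : Graph k) where

  Admissible : (Fin k → Bool) → Set
  Admissible W = NonEmpty W × (∀ v → T (W v) → ∃ λ u → T (W u) × u ≢ v × Adjacent G v u)

  T-admissibleᵇ : (W : Fin k → Bool) → T (admissibleᵇ G W) ⇔ Admissible W
  T-admissibleᵇ W = mk⇔ forward backward
    where
    forward : T (admissibleᵇ G W) → Admissible W
    forward t = to (countFin-positive W) t₁ , λ v ∈v →
      let (u , t′) = to (countFin-positive _) (to (T-implies _ _) (to (T-allFinᵇ _) t₂ v) ∈v)
          (∈u , t″) = to T-∧ t′
          (u≠v , a) = to T-∧ t″
      in u , ∈u , (λ u≡v → to (T-not _) u≠v (from ==⇔≡ u≡v)) , a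
      where
      t₁ = proj₁ (to T-∧ t)
      t₂ = proj₂ (to T-∧ t)
    backward : Admissible W → T (admissibleᵇ G W)
    backward (ne , nbr) = from T-∧ (from (countFin-positive W) ne , from (T-allFinᵇ _) λ v → from (T-implies _ _) λ ∈v →
      let (u , ∈u , u≢v , a) = nbr v ∈v in
      from (countFin-positive _) (u , from T-∧ (∈u , from T-∧ (from (T-not _) (u≢v ∘ to ==⇔≡) , a))))

  Contractible⇔ : {κ : Fin k → Fin m} {W : Fin k → Bool} →
                  (Admissible W × ConstantOn W κ × ClashesWithin G W κ) ⇔ (AlmostProper G κ × ∀ v → clashes G κ v ≡ W v)
  Contractible⇔ {κ = κ} {W} = mk⇔
    (λ ((ne , nbr) , const , within) →
       let W→Clash : ∀ {v} → T (W v) → Clash G κ v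
           W→Clash {v} ∈v = let (u , ∈u , _ , a) = nbr v ∈v in u , a , const v u ∈v ∈u
           Clash→W : ∀ {v} → Clash G κ v → T (W v)
           Clash→W {v} (u , a , e) = proj₁ (within v u a e)
       in ((proj₁ ne , from (T-clashes G) (W→Clash (proj₂ ne))) ,
           λ u v cu cv → const u v (Clash→W (to (T-clashes G) cu)) (Clash→W (to (T-clashes G) cv))) ,
          λ v → T-⇔→≡ (mk⇔ (Clash→W ∘ to (T-clashes G)) (from (T-clashes G) ∘ W→Clash)))
    (λ (((v₀ , c₀) , const) , Z≡W) →
       let Clash→W : ∀ {v} → Clash G κ v → T (W v)
           Clash→W {v} c = subst T (Z≡W v) (from (T-clashes G) c)
           W→Clash : ∀ {v} → T (W v) → Clash G κ v
           W→Clash {v} ∈v = to (T-clashes G) (subst T (sym (Z≡W v)) ∈v)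
       in ((v₀ , subst T (Z≡W v₀) c₀) ,
           λ v ∈v → let (u , a , e) = W→Clash ∈v in
                    u , Clash→W (v , Adjacent-sym G a , sym e) , (λ u≡v → Adjacent-irrefl G (subst (Adjacent G v) u≡v a)) , a) ,
          (λ u v ∈u ∈v → const u v (subst T (sym (Z≡W u)) ∈u) (subst T (sym (Z≡W v)) ∈v)) ,
          λ u v a e → Clash→W (v , a , e) , Clash→W (u , Adjacent-sym G a , sym e))

  ∑-admissible-coeffX : (α : Fin m → ℕ) →
    sum (map (λ W → coeffX (contract G W) m α) (admissibleSubsets G)) ≡
    ∑[ κ ← funs k (allFin m) ] (⟦ hasSizes? α κ ⟧ * ⟦ almostProper? G κ ⟧)
  ∑-admissible-coeffX {m} α = begin
    sum (map (λ W → coeffX (contract G W) m α) (admissibleSubsets G))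
      ≡⟨ ∑←-filterᵇ (admissibleᵇ G) Ws (λ W → coeffX (contract G W) m α) ⟩
    ∑[ W ← Ws ] (Adm W * coeffX (contract G W) m α)
      ≡⟨ ∑←-cong Ws (λ W → ⟦⟧*-cong (T? (admissibleᵇ G W)) λ adm →
           let ((w₀ , w₀∈W) , _) = to (T-admissibleᵇ W) adm in coeffX-contract G W w₀∈W α) ⟩
    ∑[ W ← Ws ] (Adm W * ∑[ κ ← Ks ] ⟦ contractible? W κ ⟧)
      ≡⟨ ∑←-cong Ws (λ W → *-distribˡ-∑← (Adm W) Ks λ κ → ⟦ contractible? W κ ⟧) ⟩
    ∑[ W ← Ws ] ∑[ κ ← Ks ] (Adm W * ⟦ contractible? W κ ⟧)
      ≡⟨ ∑←-comm Ws Ks (λ W κ → Adm W * ⟦ contractible? W κ ⟧) ⟩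
    ∑[ κ ← Ks ] ∑[ W ← Ws ] (Adm W * ⟦ contractible? W κ ⟧)
      ≡⟨ ∑←-cong Ks (λ κ → ∑←-cong Ws λ W → ⟦⟧*⟦⟧-cong {P? = T? (admissibleᵇ G W)} {Q? = contractible? W κ}
                                                      {R? = hasSizes? α κ} {S? = almostProper? G κ ×-dec isClashSet? κ W} regroup) ⟩
    ∑[ κ ← Ks ] ∑[ W ← Ws ] (⟦ hasSizes? α κ ⟧ * ⟦ almostProper? G κ ×-dec isClashSet? κ W ⟧)
      ≡⟨ ∑←-cong Ks (λ κ → ∑←-cong Ws λ W → cong (⟦ hasSizes? α κ ⟧ *_) (⟦⟧-× (almostProper? G κ) (isClashSet? κ W))) ⟩
    ∑[ κ ← Ks ] ∑[ W ← Ws ] (⟦ hasSizes? α κ ⟧ * (⟦ almostProper? G κ ⟧ * ⟦ isClashSet? κ W ⟧))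
      ≡⟨ ∑←-cong Ks (λ κ → trans (sym (*-distribˡ-∑← ⟦ hasSizes? α κ ⟧ Ws _)) (cong (⟦ hasSizes? α κ ⟧ *_)
           (trans (sym (*-distribˡ-∑← ⟦ almostProper? G κ ⟧ Ws λ W → ⟦ isClashSet? κ W ⟧))
                  (trans (cong (⟦ almostProper? G κ ⟧ *_) (∑-subsets-unique (clashes G κ))) (*-identityʳ _))))) ⟩
    ∑[ κ ← Ks ] (⟦ hasSizes? α κ ⟧ * ⟦ almostProper? G κ ⟧) ∎
    where
    open ≡-Reasoning
    Ws = allSubsets k
    Ks = funs k (allFin m)
    Adm : (Fin k → Bool) → ℕ
    Adm W = ⟦ T? (admissibleᵇ G W) ⟧
    contractible? : (W : Fin k → Bool) (κ : Fin k → Fin m) → Dec ((ConstantOn W κ × ClashesWithin G W κ) × HasSizes α κ)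
    contractible? W κ = (constantOn? W κ ×-dec clashesWithin? G W κ) ×-dec hasSizes? α κ
    isClashSet? : (κ : Fin k → Fin m) (W : Fin k → Bool) → Dec (∀ v → clashes G κ v ≡ W v)
    isClashSet? κ W = all? λ v → clashes G κ v ≟ᵇ W v
    regroup : ∀ {W κ} → (T (admissibleᵇ G W) × (ConstantOn W κ × ClashesWithin G W κ) × HasSizes α κ) ⇔
                        (HasSizes α κ × AlmostProper G κ × ∀ v → clashes G κ v ≡ W v)
    regroup {W} = mk⇔ (λ (adm , cw , hs) → hs , to Contractible⇔ (to (T-admissibleᵇ W) adm , cw))
                      (λ (hs , r) → let (adm , cw) = from Contractible⇔ r in from (T-admissibleᵇ W) adm , cw , hs)

  coeffX-unweighted : (α : Fin m → ℕ) →
    coeffX (unweighted G) m α ≡ ∑[ κ ← funs k (allFin m) ] (⟦ hasSizes? α κ ⟧ * ⟦ proper? G κ ⟧)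
  coeffX-unweighted {m} α = trans (coeffX-spec (unweighted G) α) (∑←-cong (funs k (allFin m)) λ κ →
    ⟦⟧-×-cong {P? = proper? G κ} {Q? = hasWeights? (unweighted G) α κ} {R? = hasSizes? α κ} {S? = proper? G κ}
      (mk⇔ (λ (p , w) → (λ c → trans (sym (weight-unweighted κ c)) (w c)) , p)
           (λ (h , p) → p , λ c → trans (weight-unweighted κ c) (h c))))
    where
    weight-unweighted : ∀ κ c → weight (unweighted G) κ c ≡ sizes κ c
    weight-unweighted κ c = sum-cong-≗ λ v → *-identityʳ ⟦ κ v ≟ c ⟧

module _ (G : Graph k) where

  IsHom-resp : {f g : Fin k → Fin (suc n)} → (∀ v → f v ≡ g v) → IsHom G f → IsHom G g
  IsHom-resp f≗g hom u v a with hom u v a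
  ... | inj₁ (fu≡0 , fv≡0) = inj₁ (trans (sym (f≗g u)) fu≡0 , trans (sym (f≗g v)) fv≡0)
  ... | inj₂ fu≢fv         = inj₂ λ gu≡gv → fu≢fv (trans (f≗g u) (trans gu≡gv (sym (f≗g v))))

  typeOf-resp : {f g : Fin k → Fin n} → (∀ v → f v ≡ g v) → typeOf f ≡ typeOf g
  typeOf-resp {f = f} {g} f≗g = trans (typeOf-sizes f) (trans
    (cong partitionOf (tabulate-cong λ j → sum-cong-≗ λ v → cong (λ x → ⟦ x ≟ j ⟧) (f≗g v)))
    (sym (typeOf-sizes g)))

  coeffXHom-by-colorings : (α : Fin m → ℕ) →
    coeffXHom (suc n) G m α ≡
    ∑[ κ ← funs k (allFin m) ] (⟦ hasSizes? α κ ⟧ *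
      ∑[ f ← funs k (allFin (suc n)) ] (⟦ T? (isHomᵇ (suc n) G f) ⟧ * ((suc n ∸ #classes f) ! * ⟦ sameKernel? f κ ⟧)))
  coeffXHom-by-colorings {m = m} {n = n} α = begin
    coeffXHom (suc n) G m α
      ≡⟨ ∑←-filterᵇ (isHomᵇ (suc n) G) (allFuns k (allFin (suc n))) monomial ⟩
    ∑[ f ← allFuns k (allFin (suc n)) ] (Hom f * monomial f)
      ≡⟨ ∑-allFuns (allFin (suc n)) (λ f → Hom f * monomial f) (λ {f} {g} f≗g → cong₂ _*_
           (⟦⟧-cong {P? = T? (isHomᵇ (suc n) G f)} {Q? = T? (isHomᵇ (suc n) G g)}
                    (⇔-sym (T-isHomᵇ G g) ⇔-∘ (mk⇔ (IsHom-resp f≗g) (IsHom-resp (sym ∘ f≗g)) ⇔-∘ T-isHomᵇ G f)))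
           (cong (λ t → scaleFactor (suc n) t * coeffMono m α t) (typeOf-resp f≗g))) ⟩
    ∑[ f ← Fs ] (Hom f * monomial f)
      ≡⟨ ∑←-cong Fs (λ f → cong (Hom f *_)
           (trans (monomialCoefficient f α) (cong ((suc n ∸ #classes f) ! *_) (#placements-sizes f α)))) ⟩
    ∑[ f ← Fs ] (Hom f * ((suc n ∸ #classes f) ! * ∑[ κ ← Ks ] (⟦ hasSizes? α κ ⟧ * ⟦ sameKernel? f κ ⟧)))
      ≡⟨ ∑←-cong Fs (λ f → trans (cong (Hom f *_) (*-distribˡ-∑← ((suc n ∸ #classes f) !) Ks _))
                                 (*-distribˡ-∑← (Hom f) Ks _)) ⟩
    ∑[ f ← Fs ] ∑[ κ ← Ks ] (Hom f * ((suc n ∸ #classes f) ! * (⟦ hasSizes? α κ ⟧ * ⟦ sameKernel? f κ ⟧)))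
      ≡⟨ ∑←-comm Fs Ks _ ⟩
    ∑[ κ ← Ks ] ∑[ f ← Fs ] (Hom f * ((suc n ∸ #classes f) ! * (⟦ hasSizes? α κ ⟧ * ⟦ sameKernel? f κ ⟧)))
      ≡⟨ ∑←-cong Ks (λ κ → trans (∑←-cong Fs λ f → pull-out (Hom f) ((suc n ∸ #classes f) !) ⟦ hasSizes? α κ ⟧ ⟦ sameKernel? f κ ⟧)
                                 (sym (*-distribˡ-∑← ⟦ hasSizes? α κ ⟧ Fs _))) ⟩
    ∑[ κ ← Ks ] (⟦ hasSizes? α κ ⟧ * ∑[ f ← Fs ] (Hom f * ((suc n ∸ #classes f) ! * ⟦ sameKernel? f κ ⟧))) ∎
    where
    open ≡-Reasoning
    Fs = funs k (allFin (suc n))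
    Ks = funs k (allFin m)
    Hom : (Fin k → Fin (suc n)) → ℕ
    Hom f = ⟦ T? (isHomᵇ (suc n) G f) ⟧
    monomial : (Fin k → Fin (suc n)) → ℕ
    monomial f = scaleFactor (suc n) (typeOf f) * coeffMono m α (typeOf f)
    pull-out : ∀ a b c d → a * (b * (c * d)) ≡ c * (a * (b * d))
    pull-out a b c d = trans (cong (a *_) (*-left-comm b c d)) (*-left-comm a c (b * d))

proposition5p2 : (n k : ℕ) → 1 ≤ n → k ≤ n → (G : Graph k) →
    (m : ℕ) (α : Fin m → ℕ) →
    coeffXHom n G m α ≡
      n ! * coeffX (unweighted G) m α
      + (n ∸ 1) ! * sum (map (λ W → coeffX (contract G W) m α) (admissibleSubsets G))
proposition5p2 (suc n) k _ k≤n G m α = begin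
  coeffXHom (suc n) G m α
    ≡⟨ coeffXHom-by-colorings G α ⟩
  ∑[ κ ← Ks ] (⟦ hasSizes? α κ ⟧ *
    ∑[ f ← funs k (allFin (suc n)) ] (⟦ T? (isHomᵇ (suc n) G f) ⟧ * ((suc n ∸ #classes f) ! * ⟦ sameKernel? f κ ⟧)))
    ≡⟨ ∑←-cong Ks (λ κ → cong (⟦ hasSizes? α κ ⟧ *_) (∑-homs-of-kernel G κ k≤n)) ⟩
  ∑[ κ ← Ks ] (⟦ hasSizes? α κ ⟧ * (suc n ! * ⟦ proper? G κ ⟧ + n ! * ⟦ almostProper? G κ ⟧))
    ≡⟨ ∑←-split Ks (λ κ → ⟦ hasSizes? α κ ⟧) (λ κ → ⟦ proper? G κ ⟧) (λ κ → ⟦ almostProper? G κ ⟧) (suc n !) (n !) ⟩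
  suc n ! * ∑[ κ ← Ks ] (⟦ hasSizes? α κ ⟧ * ⟦ proper? G κ ⟧)
    + n ! * ∑[ κ ← Ks ] (⟦ hasSizes? α κ ⟧ * ⟦ almostProper? G κ ⟧)
    ≡⟨ cong₂ (λ x y → suc n ! * x + n ! * y) (coeffX-unweighted G α) (∑-admissible-coeffX G α) ⟨
  suc n ! * coeffX (unweighted G) m α + n ! * sum (map (λ W → coeffX (contract G W) m α) (admissibleSubsets G)) ∎
  where
  open ≡-Reasoning
  Ks = funs k (allFin m)
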